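{- Consider an $n$-vertex graph $H$ and an equitable colouring $c:V(H)\to\Omega$. Let $c'$ be a random refinement of $c$, obtained by assigning each vertex a new unique colour independently with probability at least $0.7$. Then with high probability $D(H,\mathcal R^*c')$ has maximum degree at most $4\log n$.
   Context: "With high probability" means with probability tending to $1$ as $n\to\infty$. A colouring $c$ is equitable if for any two distinct colour classes $A,B$, $H[A]$ is regular and $H[A,B]$ is biregular. Colour refinement: $\mathcal R_Hc(v)=(c(v),(d_\omega(v))_\omega)$ with $d_\omega(v)$ the number of neighbours of $v$ of colour $\omega$; iterating until the vertex partition stabilises gives $\mathcal R^*c$. Disparity graph: for a colouring $c$, the majority graph $M(H,c)$ contains, for each (possibly equal) pair of colours $\omega,\omega'$, all possible edges between colour $\omega$ and colour $\omega'$ if at least half of them are edges of $H$, and none otherwise; $D(H,c)=M(H,c)\triangle H$.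
   Formalization: The probability with which each vertex receives a new unique colour ranges over the rationals in [0.7, 1], and log is the natural logarithm. -}

module Defs where

open import Data.Bool using (Bool; true; false; _∧_; _xor_; not; if_then_else_)
open import Data.Nat using (ℕ; zero; suc; _^_; _≡ᵇ_; _≤ᵇ_; _!)
import Data.Nat as ℕ
open import Data.Nat.Properties using (_!≢0)
open import Data.Fin using (Fin; toℕ; _≟_)
open import Data.Vec using (Vec; []; _∷_; lookup)
open import Data.List using (List; []; _∷_; map; foldr; allFin; _++_)
open import Data.Nat.ListAction using (sum)
open import Data.Integer using (+_)
open import Data.Rational using (ℚ; _/_; 0ℚ; 1ℚ; _+_; _*_; _-_; _≤_)
open import Data.Product using (_×_)
open import Relation.Nullary.Decidable using (⌊_⌋)
open import Relation.Binary.PropositionalEquality using (_≡_; _≢_)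

record Graph (n : ℕ) : Set where
  field
    adj    : Fin n → Fin n → Bool
    sym    : ∀ u v → adj u v ≡ adj v u
    irrefl : ∀ v → adj v v ≡ false
open Graph public

count : {n : ℕ} → (Fin n → Bool) → ℕ
count {n} P = sum (map (λ x → if P x then 1 else 0) (allFin n))

allB : {A : Set} → (A → Bool) → List A → Bool
allB P = foldr (λ a b → P a ∧ b) true

_==_ : {n : ℕ} → Fin n → Fin n → Bool
u == v = ⌊ u ≟ v ⌋

Colouring : ℕ → Set
Colouring n = Fin n → ℕ

degTo : {n : ℕ} → Graph n → Colouring n → Fin n → ℕ → ℕ
degTo H c v ω = count (λ x → adj H v x ∧ (c x ≡ᵇ ω))

InducedRegular : {n : ℕ} → Graph n → Colouring n → ℕ → Set
InducedRegular H c ω =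
  ∀ u v → c u ≡ ω → c v ≡ ω → degTo H c u ω ≡ degTo H c v ω

Biregular : {n : ℕ} → Graph n → Colouring n → ℕ → ℕ → Set
Biregular H c ω ω' =
  (∀ u v → c u ≡ ω → c v ≡ ω → degTo H c u ω' ≡ degTo H c v ω')
  × (∀ u v → c u ≡ ω' → c v ≡ ω' → degTo H c u ω ≡ degTo H c v ω)

Equitable : {n : ℕ} → Graph n → Colouring n → Set
Equitable H c =
  (∀ ω → InducedRegular H c ω) × (∀ ω ω' → ω ≢ ω' → Biregular H c ω ω')

-- Partitions of V(H) given by a "same colour" relation.
-- All of colour refinement and the disparity graph depend only on the
-- partition into colour classes.

Partition : ℕ → Set
Partition n = Fin n → Fin n → Bool

partitionOf : {n : ℕ} → Colouring n → Partition n
partitionOf c u v = c u ≡ᵇ c v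

degClass : {n : ℕ} → Graph n → Partition n → Fin n → Fin n → ℕ
degClass H r u x = count (λ y → adj H u y ∧ r x y)

-- one round of colour refinement R_H:  R c(u) = R c(v)  iff  c(u) = c(v)
-- and d_ω(u) = d_ω(v) for every colour ω (only occurring colours matter)
refineStep : {n : ℕ} → Graph n → Partition n → Partition n
refineStep {n} H r u v =
  r u v ∧ allB (λ x → degClass H r u x ≡ᵇ degClass H r v x) (allFin n)

iterate : {A : Set} → ℕ → (A → A) → A → A
iterate zero    f a = a
iterate (suc k) f a = f (iterate k f a)

-- R* c: the partition stabilises after at most n rounds
refine* : {n : ℕ} → Graph n → Colouring n → Partition n
refine* {n} H c = iterate n (refineStep H) (partitionOf c)

possiblePairs : {n : ℕ} → Partition n → Fin n → Fin n → ℕ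
possiblePairs {n} r u v =
  sum (map (λ x → count (λ y → r u x ∧ r v y ∧ not (x == y))) (allFin n))

edgePairs : {n : ℕ} → Graph n → Partition n → Fin n → Fin n → ℕ
edgePairs {n} H r u v =
  sum (map (λ x → count (λ y → r u x ∧ r v y ∧ adj H x y)) (allFin n))

majority : {n : ℕ} → Graph n → Partition n → Fin n → Fin n → Bool
majority H r u v =
  not (u == v) ∧ (possiblePairs r u v ≤ᵇ 2 ℕ.* edgePairs H r u v)

disparity : {n : ℕ} → Graph n → Partition n → Fin n → Fin n → Bool
disparity H r u v = majority H r u v xor adj H u v

disparityDeg : {n : ℕ} → Graph n → Partition n → Fin n → ℕ
disparityDeg H r v = count (λ u → disparity H r u v)

-- d ≤ 4 log n  (natural log)  ⟺  e^d ≤ n^4  ⟺  every partial sum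
-- Σ_{k ≤ K} d^k / k! is ≤ n^4

expPartial : ℕ → ℕ → ℚ
expPartial d zero    = 1ℚ
expPartial d (suc K) =
  expPartial d K + (+ (d ^ suc K) / (suc K) !) {{(suc K) !≢0}}

AtMost4Log : ℕ → ℕ → Set
AtMost4Log d n = ∀ K → expPartial d K ≤ + (n ^ 4) / 1

MaxDegAtMost4Log : {n : ℕ} → Graph n → Partition n → Set
MaxDegAtMost4Log {n} H r = ∀ v → AtMost4Log (disparityDeg H r v) n

-- The random refinement c' of c.
-- An outcome S : Vec Bool n records which vertices receive a new unique
-- colour; vertex v is selected independently with probability p v.

refineBy : {n : ℕ} → Colouring n → Vec Bool n → Colouring n
refineBy c S v = if lookup S v then suc (2 ℕ.* toℕ v) else 2 ℕ.* c v

allOutcomes : (n : ℕ) → List (Vec Bool n)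
allOutcomes zero    = [] ∷ []
allOutcomes (suc n) =
  map (true ∷_) (allOutcomes n) ++ map (false ∷_) (allOutcomes n)

sumℚ : List ℚ → ℚ
sumℚ = foldr _+_ 0ℚ

outcomeProb : {n : ℕ} → (Fin n → ℚ) → Vec Bool n → ℚ
outcomeProb {n} p S =
  foldr _*_ 1ℚ (map (λ v → if lookup S v then p v else 1ℚ - p v) (allFin n))

probOf : {n : ℕ} → (Fin n → ℚ) → (Vec Bool n → Bool) → ℚ
probOf {n} p E =
  sumℚ (map (λ S → if E S then outcomeProb p S else 0ℚ) (allOutcomes n))

{-# OPTIONS --safe #-}
module Submission where

-- Colour refinement stabilises after at most n rounds, at an equitable partition R = R* c′: every round
-- that changes the partition increases the number of classes. A vertex x selected by the random refinement
-- has a colour of its own, so {x} is a class of R, and equitability forces all vertices of a class of R to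
-- have the same adjacency to x. Hence for u, y in one class the neighbourhood difference N(u) △ N(y)
-- avoids the selection, which for |N(u) △ N(y)| > T happens with probability at most (3/10)^(T+1).
-- Choosing 3ᵀ ≤ n² < 3ᵀ⁺¹, a union bound over the n² pairs shows that with high probability all
-- differences inside classes have size at most T.
-- In an equitable partition, if x–v is a disparity edge then x's adjacency to v is in the minority among
-- the class C of v, so at least max(1, (|C| − 1)/2) vertices y ∈ C see x differently from v; double counting
-- these pairs bounds the disparity degree of v by 2T. Finally e^d ≤ 3^d ≤ 9ᵀ ≤ n⁴ for d ≤ 2T; by the binomial
-- theorem, each partial sum of e^(d+1) is at most 3 times the corresponding partial sum of e^d.

module Refinement where
  open import Defs hiding (sym)
  open import Data.Bool using (Bool; true; false; _∧_; _∨_; _xor_; not; if_then_else_)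
  open import Data.Bool.Properties
    using (∧-comm; xor-identityʳ; xor-same; ∨-identityʳ; ¬-not; T-≡; not-involutive) renaming (_≟_ to _≟ᵇ_)
  open import Data.Nat using (ℕ; zero; suc; _+_; _*_; _≤_; _<_; z≤n; s≤s; _≡ᵇ_; _≤ᵇ_; >-nonZero)
  open import Data.Nat.Properties renaming (suc-injective to suc-injectiveℕ) hiding (_≟_; <-cmp; _<?_; 0≢1+n)
  import Data.Nat.Properties as ℕ
  import Data.Nat.ListAction as List
  open import Data.Vec using (Vec; []; _∷_; lookup)
  open import Data.Fin using (Fin; toℕ) renaming (zero to fzero; suc to fsuc; _<_ to _<ᶠ_)
  open import Data.Fin.Properties using (0≢1+n; suc-injective; all?; ¬∀⟶∃¬; toℕ-injective)
    renaming (_≟_ to _≟ᶠ_; _<?_ to _<?ᶠ_; <-cmp to <-cmpᶠ)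
  open import Data.List using ([]; _∷_; tabulate; map; allFin)
  open import Data.List.Properties using (map-tabulate)
  open import Data.Product using (_×_; _,_; proj₁; proj₂; ∃-syntax)
  open import Data.Nat.Solver using (module +-*-Solver)
  open import Function using (_∘_; id; case_of_; Equivalence)
  open import Relation.Nullary using (¬_; Dec; yes; no; does; contradiction)
  open import Relation.Nullary.Decidable using (dec-true; decidable-stable)
  open import Relation.Binary.Definitions using (tri<; tri≈; tri>)
  open import Relation.Binary.PropositionalEquality
  open import Relation.Binary.Structures using (IsEquivalence)
  open import Algebra.Properties.Semiring.Sum ℕ.+-*-semiring
    using (sum; sum-syntax; sum-cong-≗; ∑-distrib-+; ∑-comm; *-distribˡ-sum; *-distribʳ-sum)

  𝟙 : Bool → ℕ
  𝟙 b = if b then 1 else 0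

  𝟙-mono : ∀ {a b} → (a ≡ true → b ≡ true) → 𝟙 a ≤ 𝟙 b
  𝟙-mono {false} _   = z≤n
  𝟙-mono {true}  a⇒b rewrite a⇒b refl = ≤-refl

  𝟙≤1 : ∀ b → 𝟙 b ≤ 1
  𝟙≤1 b = 𝟙-mono {b} {true} (λ _ → refl)

  𝟙-injective : ∀ {a b} → 𝟙 a ≡ 𝟙 b → a ≡ b
  𝟙-injective {false} {false} _ = refl
  𝟙-injective {true}  {true}  _ = refl

  ∧-true⁻ : ∀ {a b} → a ∧ b ≡ true → (a ≡ true) × (b ≡ true)
  ∧-true⁻ {true} {true} _ = refl , refl

  ∧-true⁺ : ∀ {a b} → a ≡ true → b ≡ true → a ∧ b ≡ true
  ∧-true⁺ refl refl = refl

  not-true⁻ : ∀ {b} → not b ≡ true → b ≡ false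
  not-true⁻ {false} _ = refl

  bool-≡ : ∀ {a b} → (a ≡ true → b ≡ true) → (b ≡ true → a ≡ true) → a ≡ b
  bool-≡ {false} {false} _ _ = refl
  bool-≡ {false} {true}  _ b⇒a = b⇒a refl
  bool-≡ {true}  {_}     a⇒b _ = sym (a⇒b refl)

  ≡ᵇ-true⁻ : ∀ {m k} → (m ≡ᵇ k) ≡ true → m ≡ k
  ≡ᵇ-true⁻ {m} {k} h = ≡ᵇ⇒≡ m k (Equivalence.from T-≡ h)

  ≡ᵇ-true⁺ : ∀ {m k} → m ≡ k → (m ≡ᵇ k) ≡ true
  ≡ᵇ-true⁺ {m} {k} m≡k = Equivalence.to T-≡ (≡⇒≡ᵇ m k m≡k)

  ≤ᵇ-true⁻ : ∀ {m k} → (m ≤ᵇ k) ≡ true → m ≤ k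
  ≤ᵇ-true⁻ {m} {k} h = ≤ᵇ⇒≤ m k (Equivalence.from T-≡ h)

  ≤ᵇ-false⁻ : ∀ {m k} → (m ≤ᵇ k) ≡ false → ¬ m ≤ k
  ≤ᵇ-false⁻ h m≤k = contradiction (trans (sym h) (Equivalence.to T-≡ (≤⇒≤ᵇ m≤k))) λ ()

  ==-refl : {n : ℕ} (a : Fin n) → (a == a) ≡ true
  ==-refl a with a ≟ᶠ a
  ... | yes _   = refl
  ... | no a≢a = contradiction refl a≢a

  ==⇒≡ : {n : ℕ} {a b : Fin n} → (a == b) ≡ true → a ≡ b
  ==⇒≡ {a = a} {b} h with a ≟ᶠ b
  ... | yes a≡b = a≡b

  ==-≢ : {n : ℕ} {a b : Fin n} → a ≢ b → (a == b) ≡ false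
  ==-≢ {a = a} {b} a≢b = ¬-not (a≢b ∘ ==⇒≡)

  ==-false⁻ : {n : ℕ} {a b : Fin n} → (a == b) ≡ false → a ≢ b
  ==-false⁻ {a = a} a≠b refl = contradiction (trans (sym a≠b) (==-refl a)) λ ()

  ∣_∣ : {n : ℕ} → (Fin n → Bool) → ℕ
  ∣_∣ {n} P = ∑[ x < n ] 𝟙 (P x)

  _⊆_ : {n : ℕ} → (Fin n → Bool) → (Fin n → Bool) → Set
  P ⊆ Q = ∀ x → P x ≡ true → Q x ≡ true

  sum-mono-≤ : {n : ℕ} {f g : Fin n → ℕ} → (∀ x → f x ≤ g x) → sum f ≤ sum g
  sum-mono-≤ {zero}  f≤g = z≤n
  sum-mono-≤ {suc n} f≤g = +-mono-≤ (f≤g fzero) (sum-mono-≤ (f≤g ∘ fsuc))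

  sum-mono-< : {n : ℕ} {f g : Fin n → ℕ} → (∀ x → f x ≤ g x) → (a : Fin n) → f a < g a → sum f < sum g
  sum-mono-< f≤g fzero     fa<ga = +-mono-<-≤ fa<ga (sum-mono-≤ (f≤g ∘ fsuc))
  sum-mono-< f≤g (fsuc a) fa<ga = +-mono-≤-< (f≤g fzero) (sum-mono-< (f≤g ∘ fsuc) a fa<ga)

  ∣∣-cong : {n : ℕ} {P Q : Fin n → Bool} → (∀ x → P x ≡ Q x) → ∣ P ∣ ≡ ∣ Q ∣
  ∣∣-cong P≗Q = sum-cong-≗ (cong 𝟙 ∘ P≗Q)

  ∣∣-mono-< : {n : ℕ} {P Q : Fin n → Bool} → P ⊆ Q → (a : Fin n) → P a ≡ false → Q a ≡ true → ∣ P ∣ < ∣ Q ∣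
  ∣∣-mono-< P⊆Q a Pa Qa = sum-mono-< (𝟙-mono ∘ P⊆Q) a (subst₂ (λ p q → 𝟙 p < 𝟙 q) (sym Pa) (sym Qa) ≤-refl)

  ∣∣≤n : {n : ℕ} (P : Fin n → Bool) → ∣ P ∣ ≤ n
  ∣∣≤n {zero}  P = z≤n
  ∣∣≤n {suc n} P = +-mono-≤ (𝟙≤1 (P fzero)) (∣∣≤n (P ∘ fsuc))

  ∣∣-empty : {n : ℕ} {P : Fin n → Bool} → (∀ x → P x ≡ false) → ∣ P ∣ ≡ 0
  ∣∣-empty {zero}  ¬P = refl
  ∣∣-empty {suc n} ¬P rewrite ¬P fzero = ∣∣-empty (¬P ∘ fsuc)

  ∣∣-pos : {n : ℕ} {P : Fin n → Bool} (a : Fin n) → P a ≡ true → 1 ≤ ∣ P ∣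
  ∣∣-pos {n} {P} a Pa = subst (_< ∣ P ∣) (∣∣-empty {n} {λ _ → false} (λ _ → refl)) (∣∣-mono-< (λ _ ()) a refl Pa)

  ∣∣-singleton : {n : ℕ} {P : Fin n → Bool} (a : Fin n) → (∀ x → P x ≡ true → x ≡ a) → P a ≡ true → ∣ P ∣ ≡ 1
  ∣∣-singleton {suc n} {P} fzero only-a Pa rewrite Pa =
    cong suc (∣∣-empty λ x → ¬-not (0≢1+n ∘ sym ∘ only-a (fsuc x)))
  ∣∣-singleton {suc n} {P} (fsuc a) only-a Pa rewrite ¬-not {P fzero} (0≢1+n ∘ only-a fzero) =
    ∣∣-singleton a (λ x → suc-injective ∘ only-a (fsuc x)) Pa

  ∣∣-∧== : {n : ℕ} (P : Fin n → Bool) (a : Fin n) → ∣ (λ y → P y ∧ (a == y)) ∣ ≡ 𝟙 (P a)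
  ∣∣-∧== P a with P a in Pa
  ... | true  = ∣∣-singleton a (λ y → sym ∘ ==⇒≡ ∘ proj₂ ∘ ∧-true⁻ {P y}) (∧-true⁺ Pa (==-refl a))
  ... | false = ∣∣-empty λ y → ¬-not λ Py∧a=y → case ==⇒≡ (proj₂ (∧-true⁻ {P y} Py∧a=y)) of λ where
    refl → contradiction (trans (sym Pa) (proj₁ (∧-true⁻ Py∧a=y))) λ ()

  ∣∣-split : {n : ℕ} (P Q : Fin n → Bool) → ∣ P ∣ ≡ ∣ (λ y → P y ∧ Q y) ∣ + ∣ (λ y → P y ∧ not (Q y)) ∣
  ∣∣-split P Q = trans (sum-cong-≗ λ y → 𝟙-split (P y) (Q y))
                       (∑-distrib-+ (λ y → 𝟙 (P y ∧ Q y)) (λ y → 𝟙 (P y ∧ not (Q y))))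
    where
    𝟙-split : ∀ a b → 𝟙 a ≡ 𝟙 (a ∧ b) + 𝟙 (a ∧ not b)
    𝟙-split false _     = refl
    𝟙-split true  false = refl
    𝟙-split true  true  = refl

  ∣∣-split-at : {n : ℕ} (P : Fin n → Bool) (a : Fin n) → ∣ P ∣ ≡ 𝟙 (P a) + ∣ (λ y → P y ∧ not (a == y)) ∣
  ∣∣-split-at P a = trans (∣∣-split P (a ==_)) (cong (_+ ∣ (λ y → P y ∧ not (a == y)) ∣) (∣∣-∧== P a))

  least-witness : {n : ℕ} (P : Fin n → Bool) (a : Fin n) → P a ≡ true →
    ∃[ m ] (P m ≡ true × ∀ u → u <ᶠ m → P u ≡ false)
  least-witness {suc n} P a Pa with P fzero in P0
  ... | true = fzero , P0 , λ _ ()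
  least-witness {suc n} P fzero    Pa | false = contradiction (trans (sym P0) Pa) λ ()
  least-witness {suc n} P (fsuc a) Pa | false with least-witness (P ∘ fsuc) a Pa
  ... | m , Pm , below-m = fsuc m , Pm , λ { fzero _ → P0 ; (fsuc u) (s≤s u<m) → below-m u u<m }

  sum-tabulate : {n : ℕ} (f : Fin n → ℕ) → List.sum (tabulate f) ≡ sum f
  sum-tabulate {zero}  f = refl
  sum-tabulate {suc n} f = cong (f fzero +_) (sum-tabulate (f ∘ fsuc))

  sum-allFin : {n : ℕ} (f : Fin n → ℕ) → List.sum (map f (allFin n)) ≡ sum f
  sum-allFin f = trans (cong List.sum (map-tabulate id f)) (sum-tabulate f)

  count≡∣∣ : {n : ℕ} (P : Fin n → Bool) → count P ≡ ∣ P ∣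
  count≡∣∣ P = sum-allFin (𝟙 ∘ P)

  count-cong : {n : ℕ} {P Q : Fin n → Bool} → (∀ x → P x ≡ Q x) → count P ≡ count Q
  count-cong {P = P} {Q} P≗Q = begin
    count P ≡⟨ count≡∣∣ P ⟩
    ∣ P ∣   ≡⟨ ∣∣-cong P≗Q ⟩
    ∣ Q ∣   ≡⟨ count≡∣∣ Q ⟨
    count Q ∎
    where open ≡-Reasoning

  count-empty : {n : ℕ} → count {n} (λ _ → false) ≡ 0
  count-empty {n} = trans (count≡∣∣ {n} (λ _ → false)) (∣∣-empty {n} λ _ → refl)

  allB-tabulate⁻ : {A : Set} {n : ℕ} {P : A → Bool} (g : Fin n → A) → allB P (tabulate g) ≡ true → ∀ i → P (g i) ≡ true
  allB-tabulate⁻ g all fzero    = proj₁ (∧-true⁻ all)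
  allB-tabulate⁻ {P = P} g all (fsuc i) = allB-tabulate⁻ (g ∘ fsuc) (proj₂ (∧-true⁻ {P (g fzero)} all)) i

  allB-tabulate⁺ : {A : Set} {n : ℕ} {P : A → Bool} (g : Fin n → A) → (∀ i → P (g i) ≡ true) → allB P (tabulate g) ≡ true
  allB-tabulate⁺ {n = zero}  g every = refl
  allB-tabulate⁺ {n = suc n} g every = ∧-true⁺ (every fzero) (allB-tabulate⁺ (g ∘ fsuc) (every ∘ fsuc))

  allB-allFin⁻ : {n : ℕ} {P : Fin n → Bool} → allB P (allFin n) ≡ true → ∀ x → P x ≡ true
  allB-allFin⁻ = allB-tabulate⁻ id

  allB-allFin⁺ : {n : ℕ} {P : Fin n → Bool} → (∀ x → P x ≡ true) → allB P (allFin n) ≡ true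
  allB-allFin⁺ = allB-tabulate⁺ id

  allB-cong : {A : Set} {P Q : A → Bool} → (∀ x → P x ≡ Q x) → ∀ xs → allB P xs ≡ allB Q xs
  allB-cong P≗Q []       = refl
  allB-cong P≗Q (x ∷ xs) = cong₂ _∧_ (P≗Q x) (allB-cong P≗Q xs)

  _∼[_]_ : {n : ℕ} → Fin n → Partition n → Fin n → Set
  u ∼[ r ] v = r u v ≡ true

  _⊑_ : {n : ℕ} → Partition n → Partition n → Set
  r′ ⊑ r = ∀ {u v} → u ∼[ r′ ] v → u ∼[ r ] v

  _≐_ : {n : ℕ} → Partition n → Partition n → Set
  r ≐ r′ = ∀ u v → r u v ≡ r′ u v

  ≐-dec : {n : ℕ} (r r′ : Partition n) → Dec (r ≐ r′)
  ≐-dec r r′ = all? λ u → all? λ v → r u v ≟ᵇ r′ u v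

  ≐-witness : {n : ℕ} {r r′ : Partition n} → ¬ (r ≐ r′) → ∃[ u ] ∃[ v ] (r u v ≢ r′ u v)
  ≐-witness {n} {r} {r′} r≭r′ with ¬∀⟶∃¬ n _ (λ u → all? λ v → r u v ≟ᵇ r′ u v) r≭r′
  ... | u , ¬all = u , ¬∀⟶∃¬ n _ (λ v → r u v ≟ᵇ r′ u v) ¬all

  IsEquitable : {n : ℕ} → Graph n → Partition n → Set
  IsEquitable H r = ∀ {u w} → u ∼[ r ] w → ∀ x → degClass H r u x ≡ degClass H r w x

  partitionOf-isEquivalence : {n : ℕ} (c : Colouring n) → IsEquivalence (_∼[ partitionOf c ]_)
  partitionOf-isEquivalence c = record
    { refl  = λ {u} → ≡ᵇ-true⁺ {c u} refl
    ; sym   = λ {u} {v} h → ≡ᵇ-true⁺ (sym (≡ᵇ-true⁻ {c u} {c v} h))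
    ; trans = λ {u} {v} {w} h h′ → ≡ᵇ-true⁺ (trans (≡ᵇ-true⁻ {c u} {c v} h) (≡ᵇ-true⁻ {c v} {c w} h′))
    }

  module _ {n : ℕ} (H : Graph n) (r : Partition n) where

    refineStep-⊑ : refineStep H r ⊑ r
    refineStep-⊑ = proj₁ ∘ ∧-true⁻

    refineStep-degClass : ∀ {u w} → u ∼[ refineStep H r ] w → ∀ x → degClass H r u x ≡ degClass H r w x
    refineStep-degClass {u} h x = ≡ᵇ-true⁻ (allB-allFin⁻ (proj₂ (∧-true⁻ {r u _} h)) x)

    refineStep-intro : ∀ {u w} → u ∼[ r ] w → (∀ x → degClass H r u x ≡ degClass H r w x) → u ∼[ refineStep H r ] w
    refineStep-intro u∼w same-degrees = ∧-true⁺ u∼w (allB-allFin⁺ (≡ᵇ-true⁺ ∘ same-degrees))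

    refineStep-isEquivalence : IsEquivalence (_∼[ r ]_) → IsEquivalence (_∼[ refineStep H r ]_)
    refineStep-isEquivalence eq = record
      { refl  = refineStep-intro (IsEquivalence.refl eq) (λ _ → refl)
      ; sym   = λ h → refineStep-intro (IsEquivalence.sym eq (refineStep-⊑ h)) (sym ∘ refineStep-degClass h)
      ; trans = λ h h′ → refineStep-intro (IsEquivalence.trans eq (refineStep-⊑ h) (refineStep-⊑ h′))
                           (λ x → trans (refineStep-degClass h x) (refineStep-degClass h′ x))
      }

  refineStep-cong : {n : ℕ} (H : Graph n) {r r′ : Partition n} → r ≐ r′ → refineStep H r ≐ refineStep H r′
  refineStep-cong {n} H {r} {r′} r≐r′ u v =
    cong₂ _∧_ (r≐r′ u v) (allB-cong (λ x → cong₂ _≡ᵇ_ (degClass-cong u x) (degClass-cong v x)) (allFin n))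
    where
    degClass-cong : ∀ u x → degClass H r u x ≡ degClass H r′ u x
    degClass-cong u x = count-cong (λ y → cong (adj H u y ∧_) (r≐r′ x y))

  isLeast : {n : ℕ} → Partition n → Fin n → Bool
  isLeast {n} r v = allB (λ u → not (does (u <?ᶠ v) ∧ r u v)) (allFin n)

  classCount : {n : ℕ} → Partition n → ℕ
  classCount r = ∣ isLeast r ∣

  module _ {n : ℕ} {r : Partition n} where

    isLeast⁻ : ∀ {v} → isLeast r v ≡ true → ∀ u → u <ᶠ v → r u v ≡ false
    isLeast⁻ {v} least u u<v with allB-allFin⁻ least u
    ... | h rewrite dec-true (u <?ᶠ v) u<v = trans (sym (not-involutive (r u v))) (cong not h)

    isLeast⁺ : ∀ {v} → (∀ u → u <ᶠ v → r u v ≡ false) → isLeast r v ≡ true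
    isLeast⁺ {v} none-below = allB-allFin⁺ λ u → lemma u (u <?ᶠ v)
      where
      lemma : ∀ u → (u<?v : Dec (u <ᶠ v)) → not (does u<?v ∧ r u v) ≡ true
      lemma u (yes u<v) rewrite none-below u u<v = refl
      lemma u (no _)    = refl

    module _ (r-equiv : IsEquivalence (_∼[ r ]_)) where
      private module R = IsEquivalence r-equiv

      least-of-class : ∀ a → ∃[ m ] (a ∼[ r ] m × isLeast r m ≡ true)
      least-of-class a with least-witness (r a) a R.refl
      ... | m , a∼m , below-m = m , a∼m , isLeast⁺ λ u u<m →
        ¬-not λ u∼m → contradiction (trans (sym (below-m u u<m)) (R.trans a∼m (R.sym u∼m))) λ ()

      isLeast-unique : ∀ {m m′} → m ∼[ r ] m′ → isLeast r m ≡ true → isLeast r m′ ≡ true → m ≡ m′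
      isLeast-unique {m} {m′} m∼m′ least least′ with <-cmpᶠ m m′
      ... | tri< m<m′ _ _ = contradiction (trans (sym m∼m′) (isLeast⁻ least′ m m<m′)) λ ()
      ... | tri≈ _ m≡m′ _ = m≡m′
      ... | tri> _ _ m′<m = contradiction (trans (sym (R.sym m∼m′)) (isLeast⁻ least m′ m′<m)) λ ()

  module _ {n : ℕ} {r r′ : Partition n} (r-equiv : IsEquivalence (_∼[ r ]_)) (r′-equiv : IsEquivalence (_∼[ r′ ]_))
           (r′⊑r : r′ ⊑ r) where
    private
      module R  = IsEquivalence r-equiv
      module R′ = IsEquivalence r′-equiv

    isLeast-⊑ : isLeast r ⊆ isLeast r′
    isLeast-⊑ v least = isLeast⁺ {r = r′} λ u u<v → ¬-not λ u∼′v →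
      contradiction (trans (sym (isLeast⁻ {r = r} least u u<v)) (r′⊑r u∼′v)) λ ()

    classCount-<-at : ∀ {w m} → w ∼[ r ] m → isLeast r m ≡ true → w ≢ m → isLeast r′ w ≡ true →
                      classCount r < classCount r′
    classCount-<-at {w} w∼m m-least w≢m w-least′ =
      ∣∣-mono-< isLeast-⊑ w (¬-not λ w-least → w≢m (isLeast-unique r-equiv w∼m w-least m-least)) w-least′

    -- The two r′-classes of a and b have distinct least elements; one of them is not the least of the r-class.
    classCount-< : ∀ {a b} → a ∼[ r ] b → r′ a b ≡ false → classCount r < classCount r′
    classCount-< {a} {b} a∼b a≁′b
      with least-of-class r-equiv a | least-of-class r′-equiv a | least-of-class r′-equiv b
    ... | m , a∼m , m-least | ma , a∼′ma , ma-least′ | mb , b∼′mb , mb-least′ with ma ≟ᶠ m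
    ...   | no ma≢m  = classCount-<-at (R.trans (R.sym (r′⊑r a∼′ma)) a∼m) m-least ma≢m ma-least′
    ...   | yes refl = classCount-<-at (R.trans (R.sym (r′⊑r b∼′mb)) (R.trans (R.sym a∼b) a∼m)) m-least mb≢ma mb-least′
      where
      mb≢ma : mb ≢ ma
      mb≢ma refl = contradiction (trans (sym a≁′b) (R′.trans a∼′ma (R′.sym b∼′mb))) λ ()

  module Stabilisation {n : ℕ} (H : Graph n) (r₀ : Partition n) (r₀-equiv : IsEquivalence (_∼[ r₀ ]_)) where

    round : ℕ → Partition n
    round k = iterate k (refineStep H) r₀

    round-isEquivalence : ∀ k → IsEquivalence (_∼[ round k ]_)
    round-isEquivalence zero    = r₀-equiv
    round-isEquivalence (suc k) = refineStep-isEquivalence H (round k) (round-isEquivalence k)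

    round-⊑ : ∀ k → round k ⊑ r₀
    round-⊑ zero    = id
    round-⊑ (suc k) = round-⊑ k ∘ refineStep-⊑ H (round k)

    StableAt : ℕ → Set
    StableAt k = round (suc k) ≐ round k

    stableAt-suc : ∀ {k} → StableAt k → StableAt (suc k)
    stableAt-suc = refineStep-cong H

    split-class : ∀ {k} → ¬ StableAt k → ∃[ a ] ∃[ b ] (a ∼[ round k ] b × round (suc k) a b ≡ false)
    split-class {k} unstable with ≐-witness unstable
    ... | a , b , differ with round (suc k) a b in split
    ...   | true  = contradiction (sym (refineStep-⊑ H (round k) split)) differ
    ...   | false = a , b , ¬-not (differ ∘ sym) , split

    classCount-round : ∀ k → ¬ StableAt k → k < classCount (round (suc k))
    classCount-round k unstable = ≤-<-trans (lower-bound k unstable) more-classes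
      where
      more-classes : classCount (round k) < classCount (round (suc k))
      more-classes with split-class {k} unstable
      ... | a , b , a∼b , a≁b = classCount-< (round-isEquivalence k) (round-isEquivalence (suc k)) (refineStep-⊑ H (round k)) a∼b a≁b
      lower-bound : ∀ k → ¬ StableAt k → k ≤ classCount (round k)
      lower-bound zero    _        = z≤n
      lower-bound (suc k) unstable = classCount-round k (unstable ∘ stableAt-suc {k})

    stable : StableAt n
    stable = decidable-stable (≐-dec (round (suc n)) (round n)) λ unstable →
      <-irrefl refl (<-≤-trans (classCount-round n unstable) (∣∣≤n (isLeast (round (suc n)))))

    round-isEquitable : IsEquitable H (round n)
    round-isEquitable {u} {w} u∼w = refineStep-degClass H (round n) (trans (stable u w) u∼w)

  factor-out : ∀ c e d → 2 * (c * e) + c * d ≡ c * (2 * e + d)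
  factor-out = solve 3 (λ c e d → con 2 :* (c :* e) :+ c :* d := c :* (con 2 :* e :+ d)) refl
    where open +-*-Solver

  arith-adjacent : ∀ {e f d s s₁} → 2 * e + d < s → s ≡ e + f → s ≡ suc s₁ → 1 ≤ f × s₁ ≤ 2 * f
  arith-adjacent {e} {f} {d} {s} {s₁} 2e+d<s s≡e+f s≡1+s₁ = ≤-trans (s≤s z≤n) e<f , (begin
    s₁     ≤⟨ n≤1+n s₁ ⟩
    suc s₁ ≡⟨ trans (sym s≡1+s₁) s≡e+f ⟩
    e + f  ≤⟨ +-monoˡ-≤ f (<⇒≤ e<f) ⟩
    f + f  ≡⟨ cong (f +_) (+-identityʳ f) ⟨
    2 * f  ∎)
    where
    open ≤-Reasoning
    e<f : e < f
    e<f = +-cancelˡ-< e e f (begin-strict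
      e + e     ≡⟨ cong (e +_) (+-identityʳ e) ⟨
      2 * e     ≤⟨ m≤m+n (2 * e) d ⟩
      2 * e + d <⟨ 2e+d<s ⟩
      s         ≡⟨ s≡e+f ⟩
      e + f     ∎)

  arith-nonadjacent : ∀ {e d s₁} → suc s₁ ≤ 2 * e + d → d ≤ s₁ → d ≤ 1 → 1 ≤ e × s₁ ≤ 2 * e
  arith-nonadjacent {zero}  1+s₁≤d d≤s₁ _   = contradiction (≤-trans 1+s₁≤d d≤s₁) (<-irrefl refl)
  arith-nonadjacent {suc e} {d} {s₁} 1+s₁≤2e+d _ d≤1 = s≤s z≤n , ≤-pred (begin
    suc s₁          ≤⟨ 1+s₁≤2e+d ⟩
    2 * suc e + d   ≤⟨ +-monoʳ-≤ (2 * suc e) d≤1 ⟩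
    2 * suc e + 1   ≡⟨ +-comm (2 * suc e) 1 ⟩
    suc (2 * suc e) ∎)
    where open ≤-Reasoning

  cancel-arith : ∀ {d s T} → d ≤ s * T → s * d ≤ 2 * (s * T) → d ≤ 2 * T
  cancel-arith {s = zero}        d≤0 _     = ≤-trans d≤0 z≤n
  cancel-arith {d} {suc s} {T} _ sd≤2sT = *-cancelˡ-≤ (suc s) (≤-trans sd≤2sT (≤-reflexive (swap 2 (suc s) T)))
    where
    swap : ∀ a b c → a * (b * c) ≡ b * (a * c)
    swap = solve 3 (λ a b c → a :* (b :* c) := b :* (a :* c)) refl
      where open +-*-Solver

  symDiff : {n : ℕ} → Graph n → Fin n → Fin n → Fin n → Bool
  symDiff H u w x = adj H u x xor adj H w x

  module DisparityBound {n : ℕ} (H : Graph n) {r : Partition n}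
    (r-equiv : IsEquivalence (_∼[ r ]_)) (r-equitable : IsEquitable H r) (v : Fin n) where
    private module R = IsEquivalence r-equiv

    classSize : Fin n → ℕ
    classSize x = ∣ r x ∣

    classSize-≥1 : ∀ x → 1 ≤ classSize x
    classSize-≥1 x = ∣∣-pos x R.refl

    r-cong : ∀ {x x′} → x ∼[ r ] x′ → ∀ y → r y x ≡ r y x′
    r-cong x∼x′ y = bool-≡ (λ y∼x → R.trans y∼x x∼x′) (λ y∼x′ → R.trans y∼x′ (R.sym x∼x′))

    edgePairs-≡ : ∀ x → edgePairs H r x v ≡ classSize x * degClass H r x v
    edgePairs-≡ x = begin
      edgePairs H r x v                             ≡⟨ sum-allFin pairsFrom ⟩
      ∑[ x′ < n ] pairsFrom x′                      ≡⟨ sum-cong-≗ per-vertex ⟩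
      ∑[ x′ < n ] (𝟙 (r x x′) * degClass H r x v)   ≡⟨ *-distribʳ-sum (degClass H r x v) (𝟙 ∘ r x) ⟨
      classSize x * degClass H r x v                ∎
      where
      open ≡-Reasoning
      pairsFrom : Fin n → ℕ
      pairsFrom x′ = count (λ y → r x x′ ∧ r v y ∧ adj H x′ y)
      per-vertex : ∀ x′ → pairsFrom x′ ≡ 𝟙 (r x x′) * degClass H r x v
      per-vertex x′ with r x x′ in x∼x′
      ... | false = count-empty {n}
      ... | true  = begin
        count (λ y → r v y ∧ adj H x′ y) ≡⟨ count-cong (λ y → ∧-comm (r v y) (adj H x′ y)) ⟩
        degClass H r x′ v                ≡⟨ r-equitable x∼x′ v ⟨
        degClass H r x v                 ≡⟨ *-identityˡ _ ⟨
        1 * degClass H r x v             ∎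

    -- The correction term accounts for the pairs (x′ , x′) that possiblePairs omits when x and v share a class.
    possiblePairs-≡ : ∀ x → possiblePairs r x v + classSize x * 𝟙 (r v x) ≡ classSize x * classSize v
    possiblePairs-≡ x = begin
      possiblePairs r x v + classSize x * 𝟙 (r v x)
        ≡⟨ cong₂ _+_ (sum-allFin pairsFrom) (*-distribʳ-sum (𝟙 (r v x)) (𝟙 ∘ r x)) ⟩
      ∑[ x′ < n ] pairsFrom x′ + ∑[ x′ < n ] (𝟙 (r x x′) * 𝟙 (r v x))
        ≡⟨ ∑-distrib-+ pairsFrom (λ x′ → 𝟙 (r x x′) * 𝟙 (r v x)) ⟨
      ∑[ x′ < n ] (pairsFrom x′ + 𝟙 (r x x′) * 𝟙 (r v x))
        ≡⟨ sum-cong-≗ per-vertex ⟩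
      ∑[ x′ < n ] (𝟙 (r x x′) * classSize v)
        ≡⟨ *-distribʳ-sum (classSize v) (𝟙 ∘ r x) ⟨
      classSize x * classSize v
        ∎
      where
      open ≡-Reasoning
      pairsFrom : Fin n → ℕ
      pairsFrom x′ = count (λ y → r x x′ ∧ r v y ∧ not (x′ == y))
      per-vertex : ∀ x′ → pairsFrom x′ + 𝟙 (r x x′) * 𝟙 (r v x) ≡ 𝟙 (r x x′) * classSize v
      per-vertex x′ with r x x′ in x∼x′
      ... | false = trans (+-identityʳ _) (count-empty {n})
      ... | true  = begin
        count (λ y → r v y ∧ not (x′ == y)) + 1 * 𝟙 (r v x)
          ≡⟨ cong₂ _+_ (count≡∣∣ (λ y → r v y ∧ not (x′ == y))) (trans (*-identityˡ _) (cong 𝟙 (r-cong x∼x′ v))) ⟩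
        ∣ (λ y → r v y ∧ not (x′ == y)) ∣ + 𝟙 (r v x′)
          ≡⟨ +-comm _ (𝟙 (r v x′)) ⟩
        𝟙 (r v x′) + ∣ (λ y → r v y ∧ not (x′ == y)) ∣
          ≡⟨ ∣∣-split-at (r v) x′ ⟨
        classSize v
          ≡⟨ *-identityˡ _ ⟨
        1 * classSize v
          ∎

    majority⇒ : ∀ x → possiblePairs r x v ≤ 2 * edgePairs H r x v → classSize v ≤ 2 * degClass H r x v + 𝟙 (r v x)
    majority⇒ x pp≤2ep = *-cancelˡ-≤ (classSize x) {{>-nonZero (classSize-≥1 x)}} (begin
      classSize x * classSize v                              ≡⟨ possiblePairs-≡ x ⟨
      possiblePairs r x v + classSize x * δ                  ≤⟨ +-monoˡ-≤ _ pp≤2ep ⟩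
      2 * edgePairs H r x v + classSize x * δ                ≡⟨ cong (λ ep → 2 * ep + classSize x * δ) (edgePairs-≡ x) ⟩
      2 * (classSize x * degClass H r x v) + classSize x * δ ≡⟨ factor-out (classSize x) _ _ ⟩
      classSize x * (2 * degClass H r x v + δ)               ∎)
      where
      open ≤-Reasoning
      δ = 𝟙 (r v x)

    ⇒majority : ∀ x → classSize v ≤ 2 * degClass H r x v + 𝟙 (r v x) → possiblePairs r x v ≤ 2 * edgePairs H r x v
    ⇒majority x s≤2e+δ = +-cancelʳ-≤ (classSize x * δ) _ _ (begin
      possiblePairs r x v + classSize x * δ                  ≡⟨ possiblePairs-≡ x ⟩
      classSize x * classSize v                              ≤⟨ *-monoʳ-≤ (classSize x) s≤2e+δ ⟩
      classSize x * (2 * degClass H r x v + δ)               ≡⟨ factor-out (classSize x) _ _ ⟨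
      2 * (classSize x * degClass H r x v) + classSize x * δ ≡⟨ cong (λ ep → 2 * ep + classSize x * δ) (edgePairs-≡ x) ⟨
      2 * edgePairs H r x v + classSize x * δ                ∎)
      where
      open ≤-Reasoning
      δ = 𝟙 (r v x)

    others : ℕ
    others = ∣ (λ y → r v y ∧ not (v == y)) ∣

    classSize-v : classSize v ≡ suc others
    classSize-v = trans (∣∣-split-at (r v) v) (cong (λ b → 𝟙 b + others) R.refl)

    others-≥ : ∀ {x} → x ≢ v → 𝟙 (r v x) ≤ others
    others-≥ {x} x≢v with r v x in v∼x
    ... | false = z≤n
    ... | true  = ∣∣-pos x (∧-true⁺ v∼x (cong not (==-≢ (x≢v ∘ sym))))

    inClassNeighbours : Fin n → ℕ
    inClassNeighbours x = ∣ (λ y → r v y ∧ adj H x y) ∣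

    degClass-≡ : ∀ x → degClass H r x v ≡ inClassNeighbours x
    degClass-≡ x = trans (count≡∣∣ (λ y → adj H x y ∧ r v y)) (∣∣-cong λ y → ∧-comm (adj H x y) (r v y))

    mismatches : Fin n → ℕ
    mismatches x = ∣ (λ y → r v y ∧ (adj H x y xor adj H x v)) ∣

    mismatches-adjacent : ∀ {x} → adj H x v ≡ true → classSize v ≡ inClassNeighbours x + mismatches x
    mismatches-adjacent {x} x~v = trans (∣∣-split (r v) (adj H x))
      (cong (inClassNeighbours x +_) (∣∣-cong λ y →
        trans (cong (r v y ∧_) (xor-true (adj H x y))) (cong (λ a → r v y ∧ (adj H x y xor a)) (sym x~v))))
      where
      xor-true : ∀ a → not a ≡ a xor true
      xor-true false = refl
      xor-true true  = refl

    mismatches-nonadjacent : ∀ {x} → adj H x v ≡ false → mismatches x ≡ inClassNeighbours x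
    mismatches-nonadjacent {x} x≁v = ∣∣-cong λ y →
      trans (cong (λ a → r v y ∧ (adj H x y xor a)) x≁v) (cong (r v y ∧_) (xor-identityʳ (adj H x y)))

    -- On a disparity edge x–v the adjacency of x to v is in the minority within the class of v.
    disparity⇒mismatches : ∀ x → disparity H r x v ≡ true → 1 ≤ mismatches x × others ≤ 2 * mismatches x
    disparity⇒mismatches x = by-cases (majority H r x v) (adj H x v) refl refl
      where
      by-cases : ∀ m a → majority H r x v ≡ m → adj H x v ≡ a → m xor a ≡ true →
                 1 ≤ mismatches x × others ≤ 2 * mismatches x
      by-cases true  true  _   _   ()
      by-cases false false _   _   ()
      by-cases false true  maj x~v _ =
        arith-adjacent (≰⇒> (¬pp≤2ep ∘ ⇒majority x))
          (trans (mismatches-adjacent x~v) (cong (_+ mismatches x) (sym (degClass-≡ x)))) classSize-v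
        where
        x≢v : x ≢ v
        x≢v refl = contradiction (trans (sym x~v) (irrefl H x)) λ ()
        ¬pp≤2ep : ¬ possiblePairs r x v ≤ 2 * edgePairs H r x v
        ¬pp≤2ep = ≤ᵇ-false⁻
          (trans (sym (cong (λ b → not b ∧ (possiblePairs r x v ≤ᵇ 2 * edgePairs H r x v)) (==-≢ x≢v))) maj)
      by-cases true  false maj x≁v _ =
        subst (λ m → 1 ≤ m × others ≤ 2 * m) (sym (trans (mismatches-nonadjacent x≁v) (sym (degClass-≡ x))))
          (arith-nonadjacent (subst (_≤ 2 * degClass H r x v + 𝟙 (r v x)) classSize-v
                                    (majority⇒ x (≤ᵇ-true⁻ (proj₂ (∧-true⁻ maj)))))
                             (others-≥ x≢v) (𝟙≤1 (r v x)))
        where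
        x≢v : x ≢ v
        x≢v = ==-false⁻ (not-true⁻ (proj₁ (∧-true⁻ maj)))

    ∑-mismatches : ∑[ x < n ] mismatches x ≡ ∑[ y < n ] (𝟙 (r v y) * ∣ symDiff H y v ∣)
    ∑-mismatches = trans (∑-comm (λ x y → 𝟙 (r v y ∧ (adj H x y xor adj H x v)))) (sum-cong-≗ per-vertex)
      where
      per-vertex : ∀ y → ∑[ x < n ] 𝟙 (r v y ∧ (adj H x y xor adj H x v)) ≡ 𝟙 (r v y) * ∣ symDiff H y v ∣
      per-vertex y with r v y
      ... | false = ∣∣-empty {n} λ _ → refl
      ... | true  = trans (∣∣-cong λ x → cong₂ _xor_ (Graph.sym H x y) (Graph.sym H x v)) (sym (*-identityˡ _))

    module _ {T : ℕ} (close : ∀ y → v ∼[ r ] y → y ≢ v → ∣ symDiff H y v ∣ ≤ T) where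

      ∑-mismatches-≤ : ∑[ x < n ] mismatches x ≤ others * T
      ∑-mismatches-≤ = begin
        ∑[ x < n ] mismatches x                           ≡⟨ ∑-mismatches ⟩
        ∑[ y < n ] (𝟙 (r v y) * ∣ symDiff H y v ∣)         ≤⟨ sum-mono-≤ per-vertex ⟩
        ∑[ y < n ] (𝟙 (r v y ∧ not (v == y)) * T)         ≡⟨ *-distribʳ-sum T (λ y → 𝟙 (r v y ∧ not (v == y))) ⟨
        others * T                                        ∎
        where
        open ≤-Reasoning
        per-vertex : ∀ y → 𝟙 (r v y) * ∣ symDiff H y v ∣ ≤ 𝟙 (r v y ∧ not (v == y)) * T
        per-vertex y with y ≟ᶠ v
        ... | yes refl rewrite ∣∣-empty {P = symDiff H v v} (xor-same ∘ adj H v) | *-zeroʳ (𝟙 (r v v)) = z≤n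
        ... | no y≢v rewrite ==-≢ (y≢v ∘ sym) with r v y in v∼y
        ...   | false = z≤n
        ...   | true  = *-monoʳ-≤ 1 (close y v∼y y≢v)

      disparityDeg-≤ : disparityDeg H r v ≤ 2 * T
      disparityDeg-≤ = subst (_≤ 2 * T) (sym (count≡∣∣ disparity-to-v))
        (cancel-arith {s = others} (≤-trans (sum-mono-≤ at-least-one) ∑-mismatches-≤) (begin
          others * ∣ disparity-to-v ∣                ≡⟨ *-distribˡ-sum others (𝟙 ∘ disparity-to-v) ⟩
          ∑[ x < n ] (others * 𝟙 (disparity-to-v x)) ≤⟨ sum-mono-≤ at-least-half ⟩
          ∑[ x < n ] (2 * mismatches x)              ≡⟨ *-distribˡ-sum 2 mismatches ⟨
          2 * ∑[ x < n ] mismatches x                ≤⟨ *-monoʳ-≤ 2 ∑-mismatches-≤ ⟩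
          2 * (others * T)                           ∎))
        where
        open ≤-Reasoning
        disparity-to-v : Fin n → Bool
        disparity-to-v x = disparity H r x v
        at-least-one : ∀ x → 𝟙 (disparity-to-v x) ≤ mismatches x
        at-least-one x with disparity-to-v x in x-v
        ... | false = z≤n
        ... | true  = proj₁ (disparity⇒mismatches x x-v)
        at-least-half : ∀ x → others * 𝟙 (disparity-to-v x) ≤ 2 * mismatches x
        at-least-half x with disparity-to-v x in x-v
        ... | false = ≤-trans (≤-reflexive (*-zeroʳ others)) z≤n
        ... | true  = ≤-trans (≤-reflexive (*-identityʳ others)) (proj₂ (disparity⇒mismatches x x-v))

  refineBy-unique : {n : ℕ} (c : Colouring n) (S : Vec Bool n) {x z : Fin n} →
    lookup S x ≡ true → refineBy c S z ≡ refineBy c S x → z ≡ x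
  refineBy-unique c S {x} {z} Sx same rewrite Sx with lookup S z
  ... | true  = toℕ-injective (*-cancelˡ-≡ (toℕ z) (toℕ x) 2 (suc-injectiveℕ same))
  ... | false = contradiction same (even≢odd (c z) (toℕ x))

  singleton-class-adj : {n : ℕ} (H : Graph n) {r : Partition n} → IsEquivalence (_∼[ r ]_) → IsEquitable H r →
    ∀ {x} → (∀ z → x ∼[ r ] z → z ≡ x) → ∀ {u w} → u ∼[ r ] w → adj H u x ≡ adj H w x
  singleton-class-adj H {r} r-equiv r-equitable {x} singleton u∼w =
    𝟙-injective (trans (sym (degClass-singleton _)) (trans (r-equitable u∼w x) (degClass-singleton _)))
    where
    class≡ : ∀ y → r x y ≡ (x == y)
    class≡ y = bool-≡ (λ x∼y → case singleton y x∼y of λ where refl → ==-refl x)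
                      (λ x=y → case ==⇒≡ x=y of λ where refl → IsEquivalence.refl r-equiv)
    degClass-singleton : ∀ u → degClass H r u x ≡ 𝟙 (adj H u x)
    degClass-singleton u = begin
      degClass H r u x                        ≡⟨ count≡∣∣ (λ y → adj H u y ∧ r x y) ⟩
      ∣ (λ y → adj H u y ∧ r x y) ∣           ≡⟨ ∣∣-cong (λ y → cong (adj H u y ∧_) (class≡ y)) ⟩
      ∣ (λ y → adj H u y ∧ (x == y)) ∣        ≡⟨ ∣∣-∧== (adj H u) x ⟩
      𝟙 (adj H u x)                           ∎
      where open ≡-Reasoning

  Avoids : {n : ℕ} → (Fin n → Bool) → Vec Bool n → Bool
  Avoids {zero}  D []      = true
  Avoids {suc n} D (b ∷ S) = not (b ∧ D fzero) ∧ Avoids (D ∘ fsuc) S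

  Avoids⁺ : {n : ℕ} (D : Fin n → Bool) (S : Vec Bool n) → (∀ x → lookup S x ≡ true → D x ≡ false) → Avoids D S ≡ true
  Avoids⁺ {zero}  D []          _       = refl
  Avoids⁺ {suc n} D (false ∷ S) avoided = Avoids⁺ (D ∘ fsuc) S (avoided ∘ fsuc)
  Avoids⁺ {suc n} D (true ∷ S)  avoided rewrite avoided fzero refl = Avoids⁺ (D ∘ fsuc) S (avoided ∘ fsuc)

  module _ {n : ℕ} (H : Graph n) (T : ℕ) where

    hitsIfLarge : Fin n → Fin n → Vec Bool n → Bool
    hitsIfLarge u y S = (u == y) ∨ (∣ symDiff H u y ∣ ≤ᵇ T) ∨ not (Avoids (symDiff H u y) S)

    hitsLargeDifferences : Vec Bool n → Bool
    hitsLargeDifferences S = allB (λ u → allB (λ y → hitsIfLarge u y S) (allFin n)) (allFin n)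

    -- A selected vertex is a singleton class of R* c′, so two vertices in one class of R* c′
    -- agree on their adjacency to every selected vertex.
    hitsLargeDifferences⇒disparityDeg-≤ : (c : Colouring n) (S : Vec Bool n) → hitsLargeDifferences S ≡ true →
      ∀ v → disparityDeg H (refine* H (refineBy c S)) v ≤ 2 * T
    hitsLargeDifferences⇒disparityDeg-≤ c S hits v =
      DisparityBound.disparityDeg-≤ H (round-isEquivalence n) round-isEquitable v close
      where
      c′ = refineBy c S
      open Stabilisation H (partitionOf c′) (partitionOf-isEquivalence c′)
      selected-singleton : ∀ {x} → lookup S x ≡ true → ∀ z → x ∼[ round n ] z → z ≡ x
      selected-singleton {x} Sx z x∼z = refineBy-unique c S Sx (sym (≡ᵇ-true⁻ {c′ x} (round-⊑ n x∼z)))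
      close : ∀ y → v ∼[ round n ] y → y ≢ v → ∣ symDiff H y v ∣ ≤ T
      close y v∼y y≢v = ≤ᵇ-true⁻ (small (allB-allFin⁻ (allB-allFin⁻ hits y) v))
        where
        avoids : Avoids (symDiff H y v) S ≡ true
        avoids = Avoids⁺ (symDiff H y v) S λ x Sx →
          trans (cong (_xor adj H v x) (singleton-class-adj H (round-isEquivalence n) round-isEquitable
                                          (selected-singleton Sx) (IsEquivalence.sym (round-isEquivalence n) v∼y)))
                (xor-same (adj H v x))
        small : hitsIfLarge y v S ≡ true → (∣ symDiff H y v ∣ ≤ᵇ T) ≡ true
        small h = trans (sym (∨-identityʳ _))
          (trans (sym (cong₂ (λ a b → a ∨ ((∣ symDiff H y v ∣ ≤ᵇ T) ∨ not b)) (==-≢ y≢v) avoids)) h)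

module Fractions where
  open import Data.Nat as ℕ using (ℕ; suc)
  import Data.Nat.Properties as ℕ
  open import Data.Integer as ℤ using (+_)
  import Data.Integer.Properties as ℤ
  open import Data.Rational using (ℚ; _/_; 0ℚ; 1ℚ; _+_; _*_; _≤_; _<_; toℚᵘ)
  open import Data.Rational.Properties
    using (toℚᵘ-fromℚᵘ; toℚᵘ-injective; toℚᵘ-homo-*; toℚᵘ-homo-+; toℚᵘ-cancel-≤; <-≤-trans; positive⁻¹)
  import Data.Rational.Unnormalised as ℚᵘ
  import Data.Rational.Unnormalised.Properties as ℚᵘ
  open import Relation.Binary.PropositionalEquality

  fromℕ : ℕ → ℚ
  fromℕ m = + m / 1

  toℚᵘ-/ : ∀ a b .{{_ : ℕ.NonZero b}} → toℚᵘ (+ a / b) ℚᵘ.≃ (+ a) ℚᵘ./ b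
  toℚᵘ-/ a (suc b) = toℚᵘ-fromℚᵘ (ℚᵘ.mkℚᵘ (+ a) b)

  frac-≡ : ∀ a b c d .{{_ : ℕ.NonZero b}} .{{_ : ℕ.NonZero d}} → a ℕ.* d ≡ c ℕ.* b → + a / b ≡ + c / d
  frac-≡ a (suc b) c (suc d) ad≡cb = toℚᵘ-injective (ℚᵘ.≃-trans (toℚᵘ-/ a (suc b)) (ℚᵘ.≃-trans
    (ℚᵘ.*≡* (trans (sym (ℤ.pos-* a (suc d))) (trans (cong +_ ad≡cb) (ℤ.pos-* c (suc b)))))
    (ℚᵘ.≃-sym (toℚᵘ-/ c (suc d)))))

  frac-≤ : ∀ a b c d .{{_ : ℕ.NonZero b}} .{{_ : ℕ.NonZero d}} → a ℕ.* d ℕ.≤ c ℕ.* b → + a / b ≤ + c / d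
  frac-≤ a (suc b) c (suc d) ad≤cb = toℚᵘ-cancel-≤ (ℚᵘ.≤-respʳ-≃ (ℚᵘ.≃-sym (toℚᵘ-/ c (suc d)))
    (ℚᵘ.≤-respˡ-≃ (ℚᵘ.≃-sym (toℚᵘ-/ a (suc b)))
      (ℚᵘ.*≤* (subst₂ ℤ._≤_ (ℤ.pos-* a (suc d)) (ℤ.pos-* c (suc b)) (ℤ.+≤+ ad≤cb)))))

  frac-* : ∀ a b c d .{{_ : ℕ.NonZero b}} .{{_ : ℕ.NonZero d}} →
    (+ a / b) * (+ c / d) ≡ (+ (a ℕ.* c) / (b ℕ.* d)) {{ℕ.m*n≢0 b d}}
  frac-* a (suc b) c (suc d) = toℚᵘ-injective (ℚᵘ.≃-trans (toℚᵘ-homo-* (+ a / suc b) (+ c / suc d))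
    (ℚᵘ.≃-trans (ℚᵘ.*-cong (toℚᵘ-/ a (suc b)) (toℚᵘ-/ c (suc d)))
    (ℚᵘ.≃-trans (ℚᵘ.≃-reflexive (cong (λ z → ℚᵘ.mkℚᵘ z (d ℕ.+ b ℕ.* suc d)) (sym (ℤ.pos-* a c))))
    (ℚᵘ.≃-sym (toℚᵘ-/ (a ℕ.* c) (suc b ℕ.* suc d) {{ℕ.m*n≢0 (suc b) (suc d)}})))))

  frac-+ : ∀ a b c d .{{_ : ℕ.NonZero b}} .{{_ : ℕ.NonZero d}} →
    (+ a / b) + (+ c / d) ≡ (+ (a ℕ.* d ℕ.+ c ℕ.* b) / (b ℕ.* d)) {{ℕ.m*n≢0 b d}}
  frac-+ a (suc b) c (suc d) = toℚᵘ-injective (ℚᵘ.≃-trans (toℚᵘ-homo-+ (+ a / suc b) (+ c / suc d))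
    (ℚᵘ.≃-trans (ℚᵘ.+-cong (toℚᵘ-/ a (suc b)) (toℚᵘ-/ c (suc d)))
    (ℚᵘ.≃-trans (ℚᵘ.≃-reflexive (cong (λ z → ℚᵘ.mkℚᵘ z (d ℕ.+ b ℕ.* suc d))
        (cong₂ ℤ._+_ (sym (ℤ.pos-* a (suc d))) (sym (ℤ.pos-* c (suc b))))))
    (ℚᵘ.≃-sym (toℚᵘ-/ (a ℕ.* suc d ℕ.+ c ℕ.* suc b) (suc b ℕ.* suc d) {{ℕ.m*n≢0 (suc b) (suc d)}})))))

  frac-nonNeg : ∀ a b .{{_ : ℕ.NonZero b}} → 0ℚ ≤ + a / b
  frac-nonNeg a b = frac-≤ 0 1 a b ℕ.z≤n

  fromℕ-+ : ∀ a b → fromℕ (a ℕ.+ b) ≡ fromℕ a + fromℕ b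
  fromℕ-+ a b = sym (trans (frac-+ a 1 b 1) (frac-≡ (a ℕ.* 1 ℕ.+ b ℕ.* 1) 1 (a ℕ.+ b) 1
    (solve 2 (λ a b → (a :* con 1 :+ b :* con 1) :* con 1 := (a :+ b) :* (con 1 :* con 1)) refl a b)))
    where open import Data.Nat.Solver using (module +-*-Solver)
          open +-*-Solver

  fromℕ-* : ∀ a b → fromℕ (a ℕ.* b) ≡ fromℕ a * fromℕ b
  fromℕ-* a b = sym (frac-* a 1 b 1)

  fromℕ-mono-≤ : ∀ {a b} → a ℕ.≤ b → fromℕ a ≤ fromℕ b
  fromℕ-mono-≤ {a} {b} a≤b = frac-≤ a 1 b 1 (subst₂ ℕ._≤_ (sym (ℕ.*-identityʳ a)) (sym (ℕ.*-identityʳ b)) a≤b)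

  fromℕ-pos : ∀ {m} → 0 ℕ.< m → 0ℚ < fromℕ m
  fromℕ-pos {suc m} _ = <-≤-trans (positive⁻¹ 1ℚ) (fromℕ-mono-≤ {1} {suc m} (ℕ.s≤s ℕ.z≤n))

module ExponentialSeries where
  open import Defs using (expPartial)
  open import Data.Nat as ℕ using (ℕ; zero; suc; _∸_; _^_; _!)
  import Data.Nat.Properties as ℕ
  open import Data.Integer using (+_)
  open import Data.Rational using (ℚ; _/_; 0ℚ; 1ℚ; _+_; _*_; _≤_; positive; nonNegative)
  open import Data.Rational.Properties
  open import Data.Rational.Solver using (module +-*-Solver)
  open import Relation.Binary.PropositionalEquality
  open import Function using (_∘′_)
  open Fractions
  open +-*-Solver

  ∑≤ : ℕ → (ℕ → ℚ) → ℚ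
  ∑≤ zero    f = f 0
  ∑≤ (suc K) f = ∑≤ K f + f (suc K)

  ∑≤-cong : ∀ K {f g} → (∀ j → j ℕ.≤ K → f j ≡ g j) → ∑≤ K f ≡ ∑≤ K g
  ∑≤-cong zero    f≗g = f≗g 0 ℕ.z≤n
  ∑≤-cong (suc K) f≗g = cong₂ _+_ (∑≤-cong K (λ j j≤K → f≗g j (ℕ.m≤n⇒m≤1+n j≤K))) (f≗g (suc K) ℕ.≤-refl)

  ∑≤-mono-≤ : ∀ K {f g} → (∀ j → j ℕ.≤ K → f j ≤ g j) → ∑≤ K f ≤ ∑≤ K g
  ∑≤-mono-≤ zero    f≤g = f≤g 0 ℕ.z≤n
  ∑≤-mono-≤ (suc K) f≤g = +-mono-≤ (∑≤-mono-≤ K (λ j j≤K → f≤g j (ℕ.m≤n⇒m≤1+n j≤K))) (f≤g (suc K) ℕ.≤-refl)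

  ∑≤-distrib-+ : ∀ K f g → ∑≤ K (λ j → f j + g j) ≡ ∑≤ K f + ∑≤ K g
  ∑≤-distrib-+ zero    f g = refl
  ∑≤-distrib-+ (suc K) f g rewrite ∑≤-distrib-+ K f g =
    solve 4 (λ a b c d → (a :+ b) :+ (c :+ d) := (a :+ c) :+ (b :+ d)) refl (∑≤ K f) (∑≤ K g) (f (suc K)) (g (suc K))

  *-distribˡ-∑≤ : ∀ K a f → ∑≤ K (λ j → a * f j) ≡ a * ∑≤ K f
  *-distribˡ-∑≤ zero    a f = refl
  *-distribˡ-∑≤ (suc K) a f rewrite *-distribˡ-∑≤ K a f = sym (*-distribˡ-+ a (∑≤ K f) (f (suc K)))

  ∑≤-head : ∀ K f → ∑≤ (suc K) f ≡ f 0 + ∑≤ K (f ∘′ suc)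
  ∑≤-head zero    f = refl
  ∑≤-head (suc K) f rewrite ∑≤-head K f = +-assoc (f 0) (∑≤ K (f ∘′ suc)) (f (suc (suc K)))

  term : ℕ → ℕ → ℚ
  term d k = (+ (d ^ k) / k !) {{k ℕ.!≢0}}

  expPartial-≡ : ∀ d K → expPartial d K ≡ ∑≤ K (term d)
  expPartial-≡ d zero    = refl
  expPartial-≡ d (suc K) = cong (_+ term d (suc K)) (expPartial-≡ d K)

  term-nonNeg : ∀ d k → 0ℚ ≤ term d k
  term-nonNeg d k = frac-nonNeg (d ^ k) (k !) {{k ℕ.!≢0}}

  term-suc : ∀ d k → fromℕ (suc k) * term d (suc k) ≡ fromℕ d * term d k
  term-suc d k = trans (frac-* (suc k) 1 (d ^ suc k) (suc k !) {{_}} {{suc k ℕ.!≢0}})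
    (trans (frac-≡ (suc k ℕ.* d ^ suc k) (1 ℕ.* suc k !) (d ℕ.* d ^ k) (1 ℕ.* k !)
                   {{ℕ.m*n≢0 1 (suc k !) {{_}} {{suc k ℕ.!≢0}}}} {{ℕ.m*n≢0 1 (k !) {{_}} {{k ℕ.!≢0}}}} cross)
           (sym (frac-* d 1 (d ^ k) (k !) {{_}} {{k ℕ.!≢0}})))
    where
    cross : suc k ℕ.* d ^ suc k ℕ.* (1 ℕ.* k !) ≡ d ℕ.* d ^ k ℕ.* (1 ℕ.* suc k !)
    cross = ℕS.solve 4 (λ k d dᵏ k! → (ℕS.con 1 ℕS.:+ k) ℕS.:* (d ℕS.:* dᵏ) ℕS.:* (ℕS.con 1 ℕS.:* k!)
                         ℕS.:= d ℕS.:* dᵏ ℕS.:* (ℕS.con 1 ℕS.:* ((ℕS.con 1 ℕS.:+ k) ℕS.:* k!))) refl k d (d ^ k) (k !)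
      where import Data.Nat.Solver as ℕSolver
            module ℕS = ℕSolver.+-*-Solver

  fromℕ-suc-*-cancel : ∀ k {a b} → fromℕ (suc k) * a ≡ fromℕ (suc k) * b → a ≡ b
  fromℕ-suc-*-cancel k ka≡kb = ≤-antisym
    (*-cancelˡ-≤-pos (fromℕ (suc k)) {{positive (fromℕ-pos {suc k} (ℕ.s≤s ℕ.z≤n))}} (≤-reflexive ka≡kb))
    (*-cancelˡ-≤-pos (fromℕ (suc k)) {{positive (fromℕ-pos {suc k} (ℕ.s≤s ℕ.z≤n))}} (≤-reflexive (sym ka≡kb)))

  -- The binomial theorem (x + 1)ᵏ = ∑ⱼ (k choose j) xʲ, divided by k!.
  convolution : ∀ x k → ∑≤ k (λ j → term x j * term 1 (k ∸ j)) ≡ term (suc x) k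
  convolution x zero    = refl
  convolution x (suc k) = fromℕ-suc-*-cancel k (begin
    fromℕ (suc k) * ∑≤ (suc k) w                  ≡⟨ recurrence ⟩
    fromℕ (suc x) * ∑≤ k (λ j → term x j * term 1 (k ∸ j)) ≡⟨ cong (fromℕ (suc x) *_) (convolution x k) ⟩
    fromℕ (suc x) * term (suc x) k                ≡⟨ term-suc (suc x) k ⟨
    fromℕ (suc k) * term (suc x) (suc k)          ∎)
    where
    open ≡-Reasoning
    w : ℕ → ℚ
    w j = term x j * term 1 (suc k ∸ j)
    -- Split the factor k + 1 as j + (k + 1 − j) and absorb each part into the adjacent factorial.
    recurrence : fromℕ (suc k) * ∑≤ (suc k) w ≡ fromℕ (suc x) * ∑≤ k (λ j → term x j * term 1 (k ∸ j))
    recurrence = begin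
      fromℕ (suc k) * ∑≤ (suc k) w
        ≡⟨ *-distribˡ-∑≤ (suc k) (fromℕ (suc k)) w ⟨
      ∑≤ (suc k) (λ j → fromℕ (suc k) * w j)
        ≡⟨ ∑≤-cong (suc k) split ⟩
      ∑≤ (suc k) (λ j → fromℕ j * w j + fromℕ (suc k ∸ j) * w j)
        ≡⟨ ∑≤-distrib-+ (suc k) (λ j → fromℕ j * w j) (λ j → fromℕ (suc k ∸ j) * w j) ⟩
      ∑≤ (suc k) (λ j → fromℕ j * w j) + ∑≤ (suc k) (λ j → fromℕ (suc k ∸ j) * w j)
        ≡⟨ cong₂ _+_ lower upper ⟩
      (0ℚ + fromℕ x * c) + (c + 0ℚ)
        ≡⟨ solve 2 (λ a b → (con 0ℚ :+ a :* b) :+ (b :+ con 0ℚ) := (con 1ℚ :+ a) :* b) refl (fromℕ x) c ⟩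
      (1ℚ + fromℕ x) * c
        ≡⟨ cong (_* c) (fromℕ-+ 1 x) ⟨
      fromℕ (suc x) * c
        ∎
      where
      c = ∑≤ k (λ j → term x j * term 1 (k ∸ j))
      split : ∀ j → j ℕ.≤ suc k → fromℕ (suc k) * w j ≡ fromℕ j * w j + fromℕ (suc k ∸ j) * w j
      split j j≤1+k = trans (cong (λ m → fromℕ m * w j) (sym (ℕ.m+[n∸m]≡n j≤1+k)))
                       (trans (cong (_* w j) (fromℕ-+ j (suc k ∸ j))) (*-distribʳ-+ (w j) (fromℕ j) (fromℕ (suc k ∸ j))))
      lower : ∑≤ (suc k) (λ j → fromℕ j * w j) ≡ 0ℚ + fromℕ x * c
      lower = trans (∑≤-head k (λ j → fromℕ j * w j))
        (cong₂ _+_ (*-zeroˡ (w 0))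
                   (trans (∑≤-cong k (λ j _ → shift j)) (*-distribˡ-∑≤ k (fromℕ x) (λ j → term x j * term 1 (k ∸ j)))))
        where
        shift : ∀ j → fromℕ (suc j) * (term x (suc j) * term 1 (k ∸ j)) ≡ fromℕ x * (term x j * term 1 (k ∸ j))
        shift j = trans (sym (*-assoc (fromℕ (suc j)) (term x (suc j)) (term 1 (k ∸ j))))
                   (trans (cong (_* term 1 (k ∸ j)) (term-suc x j)) (*-assoc (fromℕ x) (term x j) (term 1 (k ∸ j))))
      upper : ∑≤ (suc k) (λ j → fromℕ (suc k ∸ j) * w j) ≡ c + 0ℚ
      upper = cong₂ _+_ (∑≤-cong k shift) (trans (cong (λ m → fromℕ m * w (suc k)) (ℕ.n∸n≡0 k)) (*-zeroˡ (w (suc k))))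
        where
        shift : ∀ j → j ℕ.≤ k → fromℕ (suc k ∸ j) * w j ≡ term x j * term 1 (k ∸ j)
        shift j j≤k = trans (cong (λ m → fromℕ m * (term x j * term 1 m)) (ℕ.+-∸-assoc 1 j≤k))
          (trans (solve 3 (λ a b c → a :* (b :* c) := b :* (a :* c)) refl (fromℕ (suc (k ∸ j))) (term x j) (term 1 (suc (k ∸ j))))
            (cong (term x j *_) (trans (term-suc 1 (k ∸ j)) (*-identityˡ (term 1 (k ∸ j))))))

  cauchy-product : ∀ x K → ∑≤ K (term (suc x)) ≡ ∑≤ K (λ j → term x j * ∑≤ (K ∸ j) (term 1))
  cauchy-product x zero    = refl
  cauchy-product x (suc K) = begin
    ∑≤ K (term (suc x)) + term (suc x) (suc K)
      ≡⟨ cong₂ _+_ (cauchy-product x K) (sym (convolution x (suc K))) ⟩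
    ∑≤ K (λ j → term x j * E (K ∸ j)) + (∑≤ K (λ j → term x j * term 1 (suc K ∸ j)) + term x (suc K) * term 1 (suc K ∸ suc K))
      ≡⟨ +-assoc (∑≤ K (λ j → term x j * E (K ∸ j))) _ _ ⟨
    (∑≤ K (λ j → term x j * E (K ∸ j)) + ∑≤ K (λ j → term x j * term 1 (suc K ∸ j))) + term x (suc K) * term 1 (suc K ∸ suc K)
      ≡⟨ cong₂ _+_ (sym (∑≤-distrib-+ K _ _)) (cong (λ m → term x (suc K) * term 1 m) (ℕ.n∸n≡0 K)) ⟩
    ∑≤ K (λ j → term x j * E (K ∸ j) + term x j * term 1 (suc K ∸ j)) + term x (suc K) * E 0
      ≡⟨ cong₂ _+_ (∑≤-cong K extend) (cong (λ m → term x (suc K) * E m) (sym (ℕ.n∸n≡0 K))) ⟩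
    ∑≤ K (λ j → term x j * E (suc K ∸ j)) + term x (suc K) * E (suc K ∸ suc K)
      ∎
    where
    open ≡-Reasoning
    E : ℕ → ℚ
    E m = ∑≤ m (term 1)
    extend : ∀ j → j ℕ.≤ K → term x j * E (K ∸ j) + term x j * term 1 (suc K ∸ j) ≡ term x j * E (suc K ∸ j)
    extend j j≤K rewrite ℕ.+-∸-assoc 1 j≤K = sym (*-distribˡ-+ (term x j) (E (K ∸ j)) (term 1 (suc (K ∸ j))))

  -- Invariant: the partial sum plus its last term stays below 3, because 2/(m+2)! ≤ 1/(m+1)!.
  ∑≤-term1-≤3 : ∀ m → ∑≤ m (term 1) ≤ fromℕ 3
  ∑≤-term1-≤3 zero    = frac-≤ 1 1 3 1 (ℕ.s≤s ℕ.z≤n)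
  ∑≤-term1-≤3 (suc m) = ≤-trans (p≤p+q (term-nonNeg 1 (suc m))) (invariant m)
    where
    p≤p+q : ∀ {p q} → 0ℚ ≤ q → p ≤ p + q
    p≤p+q {p} 0≤q = ≤-trans (≤-reflexive (sym (+-identityʳ p))) (+-monoʳ-≤ p 0≤q)
    invariant : ∀ m → ∑≤ (suc m) (term 1) + term 1 (suc m) ≤ fromℕ 3
    invariant zero    = ≤-refl
    invariant (suc m) = begin
      ∑≤ (suc m) (term 1) + t + t          ≡⟨ +-assoc (∑≤ (suc m) (term 1)) t t ⟩
      ∑≤ (suc m) (term 1) + (t + t)        ≤⟨ +-monoʳ-≤ (∑≤ (suc m) (term 1)) t+t≤ ⟩
      ∑≤ (suc m) (term 1) + term 1 (suc m) ≤⟨ invariant m ⟩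
      fromℕ 3                              ∎
      where
      open ≤-Reasoning
      t = term 1 (suc (suc m))
      t+t≤ : t + t ≤ term 1 (suc m)
      t+t≤ = begin
        t + t                        ≡⟨ solve 1 (λ a → a :+ a := con (fromℕ 2) :* a) refl t ⟩
        fromℕ 2 * t                  ≤⟨ *-monoʳ-≤-nonNeg t {{nonNegative (term-nonNeg 1 (suc (suc m)))}}
                                                          (fromℕ-mono-≤ {2} {suc (suc m)} (ℕ.s≤s (ℕ.s≤s ℕ.z≤n))) ⟩
        fromℕ (suc (suc m)) * t      ≡⟨ term-suc 1 (suc m) ⟩
        1ℚ * term 1 (suc m)          ≡⟨ *-identityˡ (term 1 (suc m)) ⟩
        term 1 (suc m)               ∎

  ∑≤-term-suc-≤ : ∀ x K → ∑≤ K (term (suc x)) ≤ fromℕ 3 * ∑≤ K (term x)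
  ∑≤-term-suc-≤ x K = begin
    ∑≤ K (term (suc x))                           ≡⟨ cauchy-product x K ⟩
    ∑≤ K (λ j → term x j * ∑≤ (K ∸ j) (term 1))   ≤⟨ ∑≤-mono-≤ K (λ j _ → bound j) ⟩
    ∑≤ K (λ j → fromℕ 3 * term x j)               ≡⟨ *-distribˡ-∑≤ K (fromℕ 3) (term x) ⟩
    fromℕ 3 * ∑≤ K (term x)                       ∎
    where
    open ≤-Reasoning
    bound : ∀ j → term x j * ∑≤ (K ∸ j) (term 1) ≤ fromℕ 3 * term x j
    bound j = ≤-trans (*-monoˡ-≤-nonNeg (term x j) {{nonNegative (term-nonNeg x j)}} (∑≤-term1-≤3 (K ∸ j)))
                      (≤-reflexive (*-comm (term x j) (fromℕ 3)))

  expPartial-≤ : ∀ d K → expPartial d K ≤ fromℕ (3 ^ d)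
  expPartial-≤ d K = ≤-trans (≤-reflexive (expPartial-≡ d K)) (go d)
    where
    ∑≤-term0 : ∀ K → ∑≤ K (term 0) ≡ 1ℚ
    ∑≤-term0 zero    = refl
    ∑≤-term0 (suc K) = trans (cong₂ _+_ (∑≤-term0 K) (frac-≡ 0 (suc K !) 0 1 {{suc K ℕ.!≢0}} refl)) (+-identityʳ 1ℚ)
    go : ∀ d → ∑≤ K (term d) ≤ fromℕ (3 ^ d)
    go zero    = ≤-reflexive (∑≤-term0 K)
    go (suc d) = begin
      ∑≤ K (term (suc d))        ≤⟨ ∑≤-term-suc-≤ d K ⟩
      fromℕ 3 * ∑≤ K (term d)    ≤⟨ *-monoˡ-≤-nonNeg (fromℕ 3) {{nonNegative (frac-nonNeg 3 1)}} (go d) ⟩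
      fromℕ 3 * fromℕ (3 ^ d)    ≡⟨ fromℕ-* 3 (3 ^ d) ⟨
      fromℕ (3 ^ suc d)          ∎
      where open ≤-Reasoning

module Probability where
  open import Defs using (allB; sumℚ; outcomeProb; allOutcomes; probOf)
  open Refinement using (Avoids; ∣_∣)
  open import Data.Bool using (Bool; true; false; _∧_; _∨_; not; if_then_else_)
  open import Data.Nat as ℕ using (ℕ; zero; suc)
  open import Data.Fin using (Fin) renaming (zero to fzero; suc to fsuc)
  open import Data.Vec using (Vec; []; _∷_; lookup)
  open import Data.List using (List; []; _∷_; map; foldr; _++_; length)
  open import Data.List.Properties using (map-++; map-∘; map-tabulate)
  open import Data.Rational using (ℚ; 0ℚ; 1ℚ; _+_; _*_; _-_; -_; _≤_; nonNegative; +-*-rawSemiring)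
  open import Data.Rational.Properties
  open import Data.Rational.Solver using (module +-*-Solver)
  open import Algebra.Definitions.RawSemiring +-*-rawSemiring using (_^_)
  open import Data.Product using (_×_; proj₁; proj₂)
  open import Function using (_∘_; id)
  open import Relation.Binary.PropositionalEquality
  open Fractions
  open +-*-Solver

  Pr : {n : ℕ} → (Fin n → ℚ) → (Vec Bool n → Bool) → ℚ
  Pr {zero}  p E = if E [] then 1ℚ else 0ℚ
  Pr {suc n} p E = p fzero * Pr (p ∘ fsuc) (E ∘ (true ∷_)) + (1ℚ - p fzero) * Pr (p ∘ fsuc) (E ∘ (false ∷_))

  sumℚ-++ : (xs ys : List ℚ) → sumℚ (xs ++ ys) ≡ sumℚ xs + sumℚ ys
  sumℚ-++ []       ys = sym (+-identityˡ (sumℚ ys))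
  sumℚ-++ (x ∷ xs) ys rewrite sumℚ-++ xs ys = sym (+-assoc x (sumℚ xs) (sumℚ ys))

  sumℚ-map-cong : {A : Set} {f g : A → ℚ} → (∀ x → f x ≡ g x) → (xs : List A) → sumℚ (map f xs) ≡ sumℚ (map g xs)
  sumℚ-map-cong f≗g []       = refl
  sumℚ-map-cong f≗g (x ∷ xs) = cong₂ _+_ (f≗g x) (sumℚ-map-cong f≗g xs)

  sumℚ-map-* : {A : Set} (k : ℚ) (f : A → ℚ) (xs : List A) → sumℚ (map (λ x → k * f x) xs) ≡ k * sumℚ (map f xs)
  sumℚ-map-* k f []       = sym (*-zeroʳ k)
  sumℚ-map-* k f (x ∷ xs) rewrite sumℚ-map-* k f xs = sym (*-distribˡ-+ k (f x) (sumℚ (map f xs)))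

  outcomeProb-∷ : {n : ℕ} (p : Fin (suc n) → ℚ) (b : Bool) (S : Vec Bool n) →
    outcomeProb p (b ∷ S) ≡ (if b then p fzero else 1ℚ - p fzero) * outcomeProb (p ∘ fsuc) S
  outcomeProb-∷ {n} p b S =
    trans (cong (foldr _*_ 1ℚ) (map-tabulate id factor))
          (cong (factor fzero *_) (sym (cong (foldr _*_ 1ℚ) (map-tabulate id (factor ∘ fsuc)))))
    where
    factor : Fin (suc n) → ℚ
    factor v = if lookup (b ∷ S) v then p v else 1ℚ - p v

  probOf≡Pr : {n : ℕ} (p : Fin n → ℚ) (E : Vec Bool n → Bool) → probOf p E ≡ Pr p E
  probOf≡Pr {zero}  p E with E []
  ... | true  = +-identityʳ 1ℚ
  ... | false = refl
  probOf≡Pr {suc n} p E = begin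
    sumℚ (map F (map (true ∷_) A ++ map (false ∷_) A))
      ≡⟨ cong sumℚ (map-++ F (map (true ∷_) A) (map (false ∷_) A)) ⟩
    sumℚ (map F (map (true ∷_) A) ++ map F (map (false ∷_) A))
      ≡⟨ sumℚ-++ (map F (map (true ∷_) A)) (map F (map (false ∷_) A)) ⟩
    sumℚ (map F (map (true ∷_) A)) + sumℚ (map F (map (false ∷_) A))
      ≡⟨ cong₂ _+_ (cong sumℚ (sym (map-∘ A))) (cong sumℚ (sym (map-∘ A))) ⟩
    sumℚ (map (F ∘ (true ∷_)) A) + sumℚ (map (F ∘ (false ∷_)) A)
      ≡⟨ cong₂ _+_ (sumℚ-map-cong (F-∷ true) A) (sumℚ-map-cong (F-∷ false) A) ⟩
    sumℚ (map (λ S → p fzero * F′ true S) A) + sumℚ (map (λ S → (1ℚ - p fzero) * F′ false S) A)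
      ≡⟨ cong₂ _+_ (sumℚ-map-* (p fzero) (F′ true) A) (sumℚ-map-* (1ℚ - p fzero) (F′ false) A) ⟩
    p fzero * probOf (p ∘ fsuc) (E ∘ (true ∷_)) + (1ℚ - p fzero) * probOf (p ∘ fsuc) (E ∘ (false ∷_))
      ≡⟨ cong₂ (λ a b → p fzero * a + (1ℚ - p fzero) * b) (probOf≡Pr (p ∘ fsuc) _) (probOf≡Pr (p ∘ fsuc) _) ⟩
    Pr p E
      ∎
    where
    open ≡-Reasoning
    A = allOutcomes n
    F : Vec Bool (suc n) → ℚ
    F S = if E S then outcomeProb p S else 0ℚ
    F′ : Bool → Vec Bool n → ℚ
    F′ b S = if E (b ∷ S) then outcomeProb (p ∘ fsuc) S else 0ℚ
    F-∷ : ∀ b S → F (b ∷ S) ≡ (if b then p fzero else 1ℚ - p fzero) * F′ b S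
    F-∷ b S with E (b ∷ S)
    ... | true  = outcomeProb-∷ p b S
    ... | false = sym (*-zeroʳ (if b then p fzero else 1ℚ - p fzero))

  Probabilities : {n : ℕ} → (Fin n → ℚ) → Set
  Probabilities p = ∀ v → 0ℚ ≤ p v × p v ≤ 1ℚ

  1-p-nonNeg : ∀ {a} → a ≤ 1ℚ → 0ℚ ≤ 1ℚ - a
  1-p-nonNeg {a} a≤1 = ≤-trans (≤-reflexive (sym (+-inverseʳ a))) (+-monoˡ-≤ (- a) a≤1)

  Pr-cong : {n : ℕ} (p : Fin n → ℚ) {E F : Vec Bool n → Bool} → (∀ S → E S ≡ F S) → Pr p E ≡ Pr p F
  Pr-cong {zero}  p E≗F rewrite E≗F [] = refl
  Pr-cong {suc n} p E≗F = cong₂ (λ a b → p fzero * a + (1ℚ - p fzero) * b)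
    (Pr-cong (p ∘ fsuc) (E≗F ∘ (true ∷_))) (Pr-cong (p ∘ fsuc) (E≗F ∘ (false ∷_)))

  Pr-false : {n : ℕ} (p : Fin n → ℚ) → Pr p (λ _ → false) ≡ 0ℚ
  Pr-false {zero}  p = refl
  Pr-false {suc n} p rewrite Pr-false (p ∘ fsuc) =
    solve 2 (λ a b → a :* con 0ℚ :+ b :* con 0ℚ := con 0ℚ) refl (p fzero) (1ℚ - p fzero)

  Pr-not : {n : ℕ} (p : Fin n → ℚ) (E : Vec Bool n → Bool) → Pr p E + Pr p (not ∘ E) ≡ 1ℚ
  Pr-not {zero}  p E with E []
  ... | true  = +-identityʳ 1ℚ
  ... | false = +-identityˡ 1ℚ
  Pr-not {suc n} p E = begin
    (a * A + (1ℚ - a) * B) + (a * A′ + (1ℚ - a) * B′)   ≡⟨ solve 6 (λ a b A B A′ B′ → (a :* A :+ b :* B) :+ (a :* A′ :+ b :* B′)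
                                                                   := a :* (A :+ A′) :+ b :* (B :+ B′)) refl a (1ℚ - a) A B A′ B′ ⟩
    a * (A + A′) + (1ℚ - a) * (B + B′)                 ≡⟨ cong₂ (λ x y → a * x + (1ℚ - a) * y) (Pr-not (p ∘ fsuc) _) (Pr-not (p ∘ fsuc) _) ⟩
    a * 1ℚ + (1ℚ - a) * 1ℚ                             ≡⟨ solve 1 (λ a → a :* con 1ℚ :+ (con 1ℚ :- a) :* con 1ℚ := con 1ℚ) refl a ⟩
    1ℚ                                                 ∎
    where
    open ≡-Reasoning
    a  = p fzero
    A  = Pr (p ∘ fsuc) (E ∘ (true ∷_))
    B  = Pr (p ∘ fsuc) (E ∘ (false ∷_))
    A′ = Pr (p ∘ fsuc) (not ∘ E ∘ (true ∷_))
    B′ = Pr (p ∘ fsuc) (not ∘ E ∘ (false ∷_))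


  *-nonNeg : ∀ {a b} → 0ℚ ≤ a → 0ℚ ≤ b → 0ℚ ≤ a * b
  *-nonNeg {a} {b} 0≤a 0≤b = ≤-trans (≤-reflexive (sym (*-zeroʳ a))) (*-monoˡ-≤-nonNeg a {{nonNegative 0≤a}} 0≤b)

  ^-nonNeg : ∀ {q} → 0ℚ ≤ q → ∀ m → 0ℚ ≤ q ^ m
  ^-nonNeg 0≤q zero    = frac-≤ 0 1 1 1 ℕ.z≤n
  ^-nonNeg 0≤q (suc m) = *-nonNeg 0≤q (^-nonNeg 0≤q m)

  ^-antitone : ∀ {q} → 0ℚ ≤ q → q ≤ 1ℚ → ∀ {a b} → a ℕ.≤ b → q ^ b ≤ q ^ a
  ^-antitone 0≤q q≤1 {zero}  {zero}  _ = ≤-refl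
  ^-antitone {q} 0≤q q≤1 {zero}  {suc b} _ = begin
    q * q ^ b   ≤⟨ *-monoʳ-≤-nonNeg (q ^ b) {{nonNegative (^-nonNeg 0≤q b)}} q≤1 ⟩
    1ℚ * q ^ b  ≡⟨ *-identityˡ (q ^ b) ⟩
    q ^ b       ≤⟨ ^-antitone 0≤q q≤1 {zero} {b} ℕ.z≤n ⟩
    1ℚ          ∎
    where open ≤-Reasoning
  ^-antitone {q} 0≤q q≤1 {suc a} {suc b} (ℕ.s≤s a≤b) = *-monoˡ-≤-nonNeg q {{nonNegative 0≤q}} (^-antitone 0≤q q≤1 a≤b)

  module _ {n : ℕ} {p : Fin (suc n) → ℚ} (p-prob : Probabilities p) where
    weighted-≤ : ∀ {a a′ b b′} → a ≤ a′ → b ≤ b′ → p fzero * a + (1ℚ - p fzero) * b ≤ p fzero * a′ + (1ℚ - p fzero) * b′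
    weighted-≤ a≤a′ b≤b′ = +-mono-≤ (*-monoˡ-≤-nonNeg (p fzero) {{nonNegative (proj₁ (p-prob fzero))}} a≤a′)
                                     (*-monoˡ-≤-nonNeg (1ℚ - p fzero) {{nonNegative (1-p-nonNeg (proj₂ (p-prob fzero)))}} b≤b′)

  Pr-∨-≤ : {n : ℕ} {p : Fin n → ℚ} → Probabilities p → (E F : Vec Bool n → Bool) → Pr p (λ S → E S ∨ F S) ≤ Pr p E + Pr p F
  Pr-∨-≤ {zero} _ E F with E [] | F []
  ... | true  | true  = frac-≤ 1 1 2 1 (ℕ.s≤s ℕ.z≤n)
  ... | true  | false = ≤-reflexive (sym (+-identityʳ 1ℚ))
  ... | false | true  = ≤-reflexive (sym (+-identityˡ 1ℚ))
  ... | false | false = ≤-refl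
  Pr-∨-≤ {suc n} {p} p-prob E F = ≤-trans
    (weighted-≤ p-prob (Pr-∨-≤ (p-prob ∘ fsuc) _ _) (Pr-∨-≤ (p-prob ∘ fsuc) _ _))
    (≤-reflexive (solve 6 (λ a b c d e f → a :* (b :+ c) :+ d :* (e :+ f) := (a :* b :+ d :* e) :+ (a :* c :+ d :* f)) refl
       (p fzero) (Pr (p ∘ fsuc) (E ∘ (true ∷_))) (Pr (p ∘ fsuc) (F ∘ (true ∷_)))
       (1ℚ - p fzero) (Pr (p ∘ fsuc) (E ∘ (false ∷_))) (Pr (p ∘ fsuc) (F ∘ (false ∷_)))))

  Pr-allB-≤ : {n : ℕ} {p : Fin n → ℚ} → Probabilities p → {A : Set} (G : A → Vec Bool n → Bool) {b : ℚ} →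
    (∀ a → Pr p (not ∘ G a) ≤ b) → ∀ xs → Pr p (λ S → not (allB (λ a → G a S) xs)) ≤ fromℕ (length xs) * b
  Pr-allB-≤ {p = p} _ G {b} _ [] = ≤-reflexive (trans (Pr-false p) (sym (*-zeroˡ b)))
  Pr-allB-≤ {p = p} p-prob G {b} each (x ∷ xs) = begin
    Pr p (λ S → not (G x S ∧ allB (λ a → G a S) xs))
      ≡⟨ Pr-cong p (λ S → not-∧ (G x S) _) ⟩
    Pr p (λ S → not (G x S) ∨ not (allB (λ a → G a S) xs))
      ≤⟨ Pr-∨-≤ p-prob _ _ ⟩
    Pr p (not ∘ G x) + Pr p (λ S → not (allB (λ a → G a S) xs))
      ≤⟨ +-mono-≤ (each x) (Pr-allB-≤ p-prob G each xs) ⟩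
    b + fromℕ (length xs) * b
      ≡⟨ solve 2 (λ b m → b :+ m :* b := (con 1ℚ :+ m) :* b) refl b (fromℕ (length xs)) ⟩
    (1ℚ + fromℕ (length xs)) * b
      ≡⟨ cong (_* b) (fromℕ-+ 1 (length xs)) ⟨
    fromℕ (length (x ∷ xs)) * b
      ∎
    where
    open ≤-Reasoning
    not-∧ : ∀ a c → not (a ∧ c) ≡ not a ∨ not c
    not-∧ true  _ = refl
    not-∧ false _ = refl

  Pr-Avoids-≤ : {n : ℕ} {p : Fin n → ℚ} → Probabilities p → ∀ {q} → (∀ v → 1ℚ - p v ≤ q) → 0ℚ ≤ q →
    (D : Fin n → Bool) → Pr p (Avoids D) ≤ q ^ ∣ D ∣
  Pr-Avoids-≤ {zero}          _      _      _   D = ≤-refl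
  Pr-Avoids-≤ {suc n} {p} p-prob {q} 1-p≤q 0≤q D with D fzero
  ... | true  = begin
    p fzero * Pr p′ (λ _ → false) + (1ℚ - p fzero) * Pr p′ (Avoids D′)
      ≡⟨ cong (λ x → p fzero * x + (1ℚ - p fzero) * Pr p′ (Avoids D′)) (Pr-false p′) ⟩
    p fzero * 0ℚ + (1ℚ - p fzero) * Pr p′ (Avoids D′)
      ≡⟨ solve 2 (λ a b → a :* con 0ℚ :+ b := b) refl (p fzero) ((1ℚ - p fzero) * Pr p′ (Avoids D′)) ⟩
    (1ℚ - p fzero) * Pr p′ (Avoids D′)
      ≤⟨ *-monoˡ-≤-nonNeg (1ℚ - p fzero) {{nonNegative (1-p-nonNeg (proj₂ (p-prob fzero)))}} IH ⟩
    (1ℚ - p fzero) * q ^ ∣ D′ ∣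
      ≤⟨ *-monoʳ-≤-nonNeg (q ^ ∣ D′ ∣) {{nonNegative (^-nonNeg 0≤q ∣ D′ ∣)}} (1-p≤q fzero) ⟩
    q * q ^ ∣ D′ ∣
      ∎
    where
    open ≤-Reasoning
    p′ = p ∘ fsuc
    D′ = D ∘ fsuc
    IH = Pr-Avoids-≤ (p-prob ∘ fsuc) (1-p≤q ∘ fsuc) 0≤q D′
  ... | false = ≤-trans (≤-reflexive (solve 2 (λ a b → a :* b :+ (con 1ℚ :- a) :* b := b) refl (p fzero) (Pr (p ∘ fsuc) (Avoids (D ∘ fsuc)))))
                        (Pr-Avoids-≤ (p-prob ∘ fsuc) (1-p≤q ∘ fsuc) 0≤q (D ∘ fsuc))

module Asymptotics where
  open import Data.Nat
  open import Data.Nat.Properties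
  open import Data.Product using (_×_; _,_; ∃-syntax)
  open import Relation.Binary.PropositionalEquality
  open import Relation.Nullary using (yes; no; contradiction)
  open import Data.Nat.Solver using (module +-*-Solver)
  open +-*-Solver

  floor-log : ∀ b → 1 < b → ∀ m → 1 ≤ m → ∃[ T ] (b ^ T ≤ m × m < b ^ suc T)
  floor-log b 1<b (suc zero)    _ = 0 , ≤-refl , subst (1 <_) (sym (*-identityʳ b)) 1<b
  floor-log b 1<b (suc (suc m)) _ with floor-log b 1<b (suc m) (s≤s z≤n)
  ... | T , bᵀ≤m , m<bᵀ⁺¹ with suc (suc m) <? b ^ suc T
  ...   | yes m+1<bᵀ⁺¹ = T , m≤n⇒m≤1+n bᵀ≤m , m+1<bᵀ⁺¹
  ...   | no  m+1≮bᵀ⁺¹ = suc T , ≮⇒≥ m+1≮bᵀ⁺¹ , (begin-strict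
    suc (suc m)        ≤⟨ m<bᵀ⁺¹ ⟩
    b ^ suc T          <⟨ ^-monoʳ-< b 1<b (n<1+n (suc T)) ⟩
    b ^ suc (suc T)    ∎)
    where open ≤-Reasoning

  9^t*[9+t]≤9*10^t : ∀ t → 9 ^ t * (9 + t) ≤ 9 * 10 ^ t
  9^t*[9+t]≤9*10^t zero    = ≤-refl
  9^t*[9+t]≤9*10^t (suc t) = begin
    9 * 9 ^ t * (10 + t)       ≡⟨ solve 2 (λ x t → con 9 :* x :* (con 10 :+ t) := x :* (con 90 :+ con 9 :* t)) refl (9 ^ t) t ⟩
    9 ^ t * (90 + 9 * t)       ≤⟨ *-monoʳ-≤ (9 ^ t) (+-monoʳ-≤ 90 (*-monoˡ-≤ t (n≤1+n 9))) ⟩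
    9 ^ t * (90 + 10 * t)      ≡⟨ solve 2 (λ x t → x :* (con 90 :+ con 10 :* t) := con 10 :* (x :* (con 9 :+ t))) refl (9 ^ t) t ⟩
    10 * (9 ^ t * (9 + t))     ≤⟨ *-monoʳ-≤ 10 (9^t*[9+t]≤9*10^t t) ⟩
    10 * (9 * 10 ^ t)          ≡⟨ solve 1 (λ x → con 10 :* (con 9 :* x) := con 9 :* (con 10 :* x)) refl (10 ^ t) ⟩
    9 * (10 * 10 ^ t)          ∎
    where open ≤-Reasoning

  k*9^t≤10^t : ∀ k t → 9 * k ≤ t → k * 9 ^ t ≤ 10 ^ t
  k*9^t≤10^t k t 9k≤t = *-cancelˡ-≤ 9 (begin
    9 * (k * 9 ^ t)                ≤⟨ m≤n+m (9 * (k * 9 ^ t)) (9 * 9 ^ t) ⟩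
    9 * 9 ^ t + 9 * (k * 9 ^ t)    ≡⟨ solve 2 (λ k x → con 9 :* x :+ con 9 :* (k :* x) := x :* (con 9 :+ con 9 :* k)) refl k (9 ^ t) ⟩
    9 ^ t * (9 + 9 * k)            ≤⟨ *-monoʳ-≤ (9 ^ t) (+-monoʳ-≤ 9 9k≤t) ⟩
    9 ^ t * (9 + t)                ≤⟨ 9^t*[9+t]≤9*10^t t ⟩
    9 * 10 ^ t                     ∎)
    where open ≤-Reasoning

  ^-cancelʳ-< : ∀ b .{{_ : NonZero b}} {x y} → b ^ x < b ^ y → x < y
  ^-cancelʳ-< b {x} {y} bˣ<bʸ with x <? y
  ... | yes x<y = x<y
  ... | no  x≮y = contradiction (^-monoʳ-≤ b (≮⇒≥ x≮y)) (<⇒≱ bˣ<bʸ)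

  3^t*3^t≡9^t : ∀ t → 3 ^ t * 3 ^ t ≡ 9 ^ t
  3^t*3^t≡9^t zero    = refl
  3^t*3^t≡9^t (suc t) = trans (solve 1 (λ x → (con 3 :* x) :* (con 3 :* x) := con 9 :* (x :* x)) refl (3 ^ t)) (cong (9 *_) (3^t*3^t≡9^t t))

  3^2T≤n^4 : ∀ {T n} → 3 ^ T ≤ n * n → 3 ^ (2 * T) ≤ n ^ 4
  3^2T≤n^4 {T} {n} 3ᵀ≤n² = begin
    3 ^ (2 * T)          ≡⟨ cong (3 ^_) (cong (T +_) (+-identityʳ T)) ⟩
    3 ^ (T + T)          ≡⟨ ^-distribˡ-+-* 3 T T ⟩
    3 ^ T * 3 ^ T        ≤⟨ *-mono-≤ 3ᵀ≤n² 3ᵀ≤n² ⟩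
    n * n * (n * n)      ≡⟨ solve 1 (λ n → n :* n :* (n :* n) := n :^ 4) refl n ⟩
    n ^ 4                ∎
    where open ≤-Reasoning

  -- n² 3ᵗ < 9ᵗ, and 9k < t gives k 9ᵗ ≤ 10ᵗ because (10/9)ᵗ ≥ 1 + t/9.
  failure-bound : ∀ k n t → 3 ^ (9 * k) ≤ n → n * n < 3 ^ t → k * (n * (n * 3 ^ t)) ≤ 10 ^ t
  failure-bound k n t 3^9k≤n n²<3ᵗ = begin
    k * (n * (n * 3 ^ t))    ≡⟨ cong (k *_) (*-assoc n n (3 ^ t)) ⟨
    k * (n * n * 3 ^ t)      ≤⟨ *-monoʳ-≤ k (*-monoˡ-≤ (3 ^ t) (<⇒≤ n²<3ᵗ)) ⟩
    k * (3 ^ t * 3 ^ t)      ≡⟨ cong (k *_) (3^t*3^t≡9^t t) ⟩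
    k * 9 ^ t                ≤⟨ k*9^t≤10^t k t (<⇒≤ 9k<t) ⟩
    10 ^ t                   ∎
    where
    open ≤-Reasoning
    instance
      n≢0 : NonZero n
      n≢0 = >-nonZero (≤-trans (m^n>0 3 (9 * k)) 3^9k≤n)
    9k<t : 9 * k < t
    9k<t = ^-cancelʳ-< 3 (≤-<-trans 3^9k≤n (≤-<-trans (m≤m*n n n) n²<3ᵗ))

module Conclusion where
  open import Defs hiding (sym)
  open Refinement
  open import Data.Bool using (Bool; true; false; not)
  open import Data.Bool.Properties using (not-involutive)
  open import Data.Nat as ℕ using (ℕ; zero; suc; _^_)
  import Data.Nat.Properties as ℕ
  open import Data.Fin using (Fin)
  open import Data.Vec using (Vec)
  open import Data.List using (allFin; length)
  open import Data.List.Properties using (length-tabulate)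
  open import Data.Integer as ℤ using (+_; -[1+_])
  open import Data.Rational using (ℚ; mkℚ; _/_; 0ℚ; 1ℚ; _+_; _*_; _-_; _≤_; _<_; *<*; positive; nonNegative; +-*-rawSemiring)
  open import Data.Rational.Properties
  open import Data.Rational.Solver using (module +-*-Solver)
  open import Algebra.Definitions.RawSemiring +-*-rawSemiring using () renaming (_^_ to _^ℚ_)
  open import Data.Product using (_×_; _,_; proj₁; proj₂; ∃-syntax)
  open import Function using (_∘_; id)
  open import Relation.Binary.PropositionalEquality
  open Fractions
  open ExponentialSeries using (expPartial-≤)
  open Probability
  open Asymptotics
  open +-*-Solver

  archimedean : ∀ ε → 0ℚ < ε → ∃[ k ] (1ℚ ≤ fromℕ k * ε)
  archimedean ε@(mkℚ (+ suc a) b _) _ = suc b , (begin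
    1ℚ                                  ≤⟨ frac-≤ 1 1 (suc b ℕ.* suc a) (1 ℕ.* suc b) cross ⟩
    + (suc b ℕ.* suc a) / (1 ℕ.* suc b) ≡⟨ frac-* (suc b) 1 (suc a) (suc b) ⟨
    fromℕ (suc b) * (+ suc a / suc b)   ≡⟨ cong (fromℕ (suc b) *_) (↥p/↧p≡p ε) ⟩
    fromℕ (suc b) * ε                   ∎)
    where
    open ≤-Reasoning
    cross : 1 ℕ.* (1 ℕ.* suc b) ℕ.≤ suc b ℕ.* suc a ℕ.* 1
    cross = subst₂ ℕ._≤_ (sym (trans (ℕ.*-identityˡ _) (ℕ.*-identityˡ _))) (sym (ℕ.*-identityʳ _)) (ℕ.m≤m*n (suc b) (suc a))
  archimedean (mkℚ (+ zero)   _ _) (*<* (ℤ.+<+ ()))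
  archimedean (mkℚ -[1+ _ ]   _ _) (*<* ())

  miss : ℚ
  miss = + 3 / 10

  0≤miss : 0ℚ ≤ miss
  0≤miss = frac-nonNeg 3 10

  miss≤1 : miss ≤ 1ℚ
  miss≤1 = frac-≤ 3 10 1 1 (ℕ.s≤s (ℕ.s≤s (ℕ.s≤s ℕ.z≤n)))

  miss^t*10^t : ∀ t → miss ^ℚ t * fromℕ (10 ^ t) ≡ fromℕ (3 ^ t)
  miss^t*10^t zero    = *-identityˡ 1ℚ
  miss^t*10^t (suc t) = begin
    (miss * miss ^ℚ t) * fromℕ (10 ℕ.* 10 ^ t)         ≡⟨ cong ((miss * miss ^ℚ t) *_) (fromℕ-* 10 (10 ^ t)) ⟩
    (miss * miss ^ℚ t) * (fromℕ 10 * fromℕ (10 ^ t))   ≡⟨ solve 4 (λ q w a b → (q :* w) :* (a :* b) := (q :* a) :* (w :* b)) refl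
                                                              miss (miss ^ℚ t) (fromℕ 10) (fromℕ (10 ^ t)) ⟩
    (miss * fromℕ 10) * (miss ^ℚ t * fromℕ (10 ^ t))   ≡⟨ cong ((miss * fromℕ 10) *_) (miss^t*10^t t) ⟩
    fromℕ 3 * fromℕ (3 ^ t)                           ≡⟨ fromℕ-* 3 (3 ^ t) ⟨
    fromℕ (3 ℕ.* 3 ^ t)                               ∎
    where open ≡-Reasoning

  failure-≤ε : ∀ {k n t ε} → 0ℚ ≤ ε → 1ℚ ≤ fromℕ k * ε → 3 ^ (9 ℕ.* k) ℕ.≤ n → n ℕ.* n ℕ.< 3 ^ t →
    fromℕ n * (fromℕ n * miss ^ℚ t) ≤ ε
  failure-≤ε {k} {n} {t} {ε} 0≤ε 1≤kε 3^9k≤n n²<3ᵗ = begin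
    X                    ≡⟨ *-identityʳ X ⟨
    X * 1ℚ               ≤⟨ *-monoˡ-≤-nonNeg X {{nonNegative 0≤X}} 1≤kε ⟩
    X * (fromℕ k * ε)    ≡⟨ solve 3 (λ x k e → x :* (k :* e) := (k :* x) :* e) refl X (fromℕ k) ε ⟩
    (fromℕ k * X) * ε    ≤⟨ *-monoʳ-≤-nonNeg ε {{nonNegative 0≤ε}} kX≤1 ⟩
    1ℚ * ε               ≡⟨ *-identityˡ ε ⟩
    ε                    ∎
    where
    open ≤-Reasoning
    X = fromℕ n * (fromℕ n * miss ^ℚ t)
    0≤X : 0ℚ ≤ X
    0≤X = *-nonNeg (frac-nonNeg n 1) (*-nonNeg (frac-nonNeg n 1) (^-nonNeg 0≤miss t))
    kX*10ᵗ≡ : fromℕ k * X * fromℕ (10 ^ t) ≡ fromℕ (k ℕ.* (n ℕ.* (n ℕ.* 3 ^ t)))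
    kX*10ᵗ≡ = begin-equality
      fromℕ k * X * fromℕ (10 ^ t)
        ≡⟨ solve 5 (λ k a w b x → k :* (a :* (a :* w)) :* x := k :* (a :* (a :* (w :* x)))) refl
             (fromℕ k) (fromℕ n) (miss ^ℚ t) (fromℕ n) (fromℕ (10 ^ t)) ⟩
      fromℕ k * (fromℕ n * (fromℕ n * (miss ^ℚ t * fromℕ (10 ^ t))))
        ≡⟨ cong (λ z → fromℕ k * (fromℕ n * (fromℕ n * z))) (miss^t*10^t t) ⟩
      fromℕ k * (fromℕ n * (fromℕ n * fromℕ (3 ^ t)))
        ≡⟨ trans (fromℕ-* k _) (cong (fromℕ k *_) (trans (fromℕ-* n _) (cong (fromℕ n *_) (fromℕ-* n (3 ^ t))))) ⟨
      fromℕ (k ℕ.* (n ℕ.* (n ℕ.* 3 ^ t)))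
        ∎
    kX≤1 : fromℕ k * X ≤ 1ℚ
    kX≤1 = *-cancelʳ-≤-pos (fromℕ (10 ^ t)) {{positive (fromℕ-pos (ℕ.m^n>0 10 t))}} (begin
      fromℕ k * X * fromℕ (10 ^ t)           ≡⟨ kX*10ᵗ≡ ⟩
      fromℕ (k ℕ.* (n ℕ.* (n ℕ.* 3 ^ t)))    ≤⟨ fromℕ-mono-≤ (failure-bound k n t 3^9k≤n n²<3ᵗ) ⟩
      fromℕ (10 ^ t)                         ≡⟨ *-identityˡ (fromℕ (10 ^ t)) ⟨
      1ℚ * fromℕ (10 ^ t)                    ∎)

  module _ {n : ℕ} (H : Graph n) (T : ℕ) where

    hitsLargeDifferences⇒MaxDegAtMost4Log : 3 ^ T ℕ.≤ n ℕ.* n → (c : Colouring n) (S : Vec Bool n) →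
      hitsLargeDifferences H T S ≡ true → MaxDegAtMost4Log H (refine* H (refineBy c S))
    hitsLargeDifferences⇒MaxDegAtMost4Log 3ᵀ≤n² c S hits v K = begin
      expPartial d K    ≤⟨ expPartial-≤ d K ⟩
      fromℕ (3 ^ d)     ≤⟨ fromℕ-mono-≤ (ℕ.≤-trans (ℕ.^-monoʳ-≤ 3 d≤2T) (3^2T≤n^4 {T} {n} 3ᵀ≤n²)) ⟩
      fromℕ (n ^ 4)     ∎
      where
      open ≤-Reasoning
      d = disparityDeg H (refine* H (refineBy c S)) v
      d≤2T : d ℕ.≤ 2 ℕ.* T
      d≤2T = hitsLargeDifferences⇒disparityDeg-≤ H T c S hits v

    module _ {p : Fin n → ℚ} (p-range : ∀ v → + 7 / 10 ≤ p v × p v ≤ 1ℚ) where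

      p-prob : Probabilities p
      p-prob v = ≤-trans (frac-nonNeg 7 10) (proj₁ (p-range v)) , proj₂ (p-range v)

      1-p≤miss : ∀ v → 1ℚ - p v ≤ miss
      1-p≤miss v = +-monoʳ-≤ 1ℚ (neg-antimono-≤ (proj₁ (p-range v)))

      Pr-misses-pair-≤ : ∀ u y → Pr p (not ∘ hitsIfLarge H T u y) ≤ miss ^ℚ suc T
      Pr-misses-pair-≤ u y with u == y in u=y | ∣ symDiff H u y ∣ ℕ.≤ᵇ T in small
      ... | true  | _     = ≤-trans (≤-reflexive (Pr-false p)) (^-nonNeg 0≤miss (suc T))
      ... | false | true  = ≤-trans (≤-reflexive (Pr-false p)) (^-nonNeg 0≤miss (suc T))
      ... | false | false = begin
        Pr p (not ∘ not ∘ Avoids D) ≡⟨ Pr-cong p (not-involutive ∘ Avoids D) ⟩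
        Pr p (Avoids D)             ≤⟨ Pr-Avoids-≤ p-prob 1-p≤miss 0≤miss D ⟩
        miss ^ℚ ∣ D ∣               ≤⟨ ^-antitone 0≤miss miss≤1 {suc T} {∣ D ∣} (ℕ.≰⇒> (≤ᵇ-false⁻ small)) ⟩
        miss ^ℚ suc T               ∎
        where
        open ≤-Reasoning
        D = symDiff H u y

      Pr-misses-≤ : Pr p (not ∘ hitsLargeDifferences H T) ≤ fromℕ n * (fromℕ n * miss ^ℚ suc T)
      Pr-misses-≤ = subst (λ m → Pr p (not ∘ hitsLargeDifferences H T) ≤ fromℕ m * (fromℕ m * miss ^ℚ suc T))
                          (length-tabulate {n = n} id)
                          (Pr-allB-≤ p-prob (λ u S → allB (λ y → hitsIfLarge H T u y S) (allFin n)) misses-from (allFin n))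
        where
        misses-from : ∀ u → Pr p (λ S → not (allB (λ y → hitsIfLarge H T u y S) (allFin n)))
                              ≤ fromℕ (length (allFin n)) * miss ^ℚ suc T
        misses-from u = Pr-allB-≤ p-prob (hitsIfLarge H T u) (Pr-misses-pair-≤ u) (allFin n)

  1-ε≤probOf : {n : ℕ} {p : Fin n → ℚ} {E : Vec Bool n → Bool} {ε : ℚ} → Pr p (not ∘ E) ≤ ε → 1ℚ - ε ≤ probOf p E
  1-ε≤probOf {p = p} {E} {ε} Pr¬E≤ε = begin
    1ℚ - ε                ≤⟨ +-monoʳ-≤ 1ℚ (neg-antimono-≤ Pr¬E≤ε) ⟩
    1ℚ - Pr p (not ∘ E)   ≡⟨ cong (_- Pr p (not ∘ E)) (Pr-not p E) ⟨
    (Pr p E + Pr p (not ∘ E)) - Pr p (not ∘ E)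
                          ≡⟨ solve 2 (λ a b → (a :+ b) :- b := a) refl (Pr p E) (Pr p (not ∘ E)) ⟩
    Pr p E                ≡⟨ probOf≡Pr p E ⟨
    probOf p E            ∎
    where open ≤-Reasoning

  -- The selection hits every neighbourhood difference of size > T, where 3ᵀ ≤ n² < 3ᵀ⁺¹.
  random-refinement : ∀ {k ε} → 0ℚ ≤ ε → 1ℚ ≤ fromℕ k * ε → ∀ n → 3 ^ (9 ℕ.* k) ℕ.≤ n →
    (H : Graph n) (c : Colouring n) (p : Fin n → ℚ) → (∀ v → + 7 / 10 ≤ p v × p v ≤ 1ℚ) →
    ∃[ good ] ((∀ S → good S ≡ true → MaxDegAtMost4Log H (refine* H (refineBy c S))) × (1ℚ - ε ≤ probOf p good))
  random-refinement {k} 0≤ε 1≤kε n 3^9k≤n H c p p-range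
    with floor-log 3 (ℕ.s≤s (ℕ.s≤s ℕ.z≤n)) (n ℕ.* n) (ℕ.*-mono-≤ 1≤n 1≤n)
    where
    1≤n : 1 ℕ.≤ n
    1≤n = ℕ.≤-trans (ℕ.m^n>0 3 (9 ℕ.* k)) 3^9k≤n
  ... | T , 3ᵀ≤n² , n²<3ᵀ⁺¹ =
    hitsLargeDifferences H T ,
    hitsLargeDifferences⇒MaxDegAtMost4Log H T 3ᵀ≤n² c ,
    1-ε≤probOf {p = p} {E = hitsLargeDifferences H T}
      (≤-trans (Pr-misses-≤ H T p-range) (failure-≤ε {k} {n} {suc T} 0≤ε 1≤kε 3^9k≤n n²<3ᵀ⁺¹))

open import Defs
open import Data.Bool using (Bool; true)
open import Data.Nat using (ℕ; _≤_)
open import Data.Fin using (Fin)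
open import Data.Vec using (Vec)
open import Data.Integer using (+_)
open import Data.Rational using (ℚ; _/_; 0ℚ; 1ℚ; _-_; _<_) renaming (_≤_ to _≤ℚ_)
open import Data.Product using (_×_; ∃-syntax)
open import Relation.Binary.PropositionalEquality using (_≡_)
open import Data.Nat using (_^_; _*_)
open import Data.Product using (_,_)
open import Data.Rational.Properties using (<⇒≤)

lemma6p7 : (ε : ℚ) → 0ℚ < ε →
    ∃[ N ] ((n : ℕ) → N ≤ n →
    (H : Graph n) (c : Colouring n) → Equitable H c →
    (p : Fin n → ℚ) → ((v : Fin n) → (+ 7 / 10 ≤ℚ p v) × (p v ≤ℚ 1ℚ)) →
    ∃[ good ] (((S : Vec Bool n) → good S ≡ true →
    MaxDegAtMost4Log H (refine* H (refineBy c S)))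
    × (1ℚ - ε ≤ℚ probOf p good)))
lemma6p7 ε 0<ε with Conclusion.archimedean ε 0<ε
... | k , 1≤kε = 3 ^ (9 * k) , λ n N≤n H c _ → Conclusion.random-refinement {k} (<⇒≤ 0<ε) 1≤kε n N≤n H c
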